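{- Let $R\subseteq[n-1]$. (i) The restriction of the bijection $\pi\mapsto B$ (where $B_h=\{\pi_1,\dots,\pi_{q_h}\}$) from $S_n^R$ to $R$-chains, to $S_n^{R\text{ - }312}$, is a bijection onto the set of $R$-rightmost clump deleting chains. (ii) The restriction of the rank $R$-tuple map $\Psi_R$ to $S_n^{R\text{ - }312}$ is a bijection onto $UG_R(n)$, whose inverse is $\Pi_R$.
   Context: Fix $n\ge1$; $[m]=\{1,\dots,m\}$, $(a,b]=\{a+1,\dots,b\}$; $\mathrm{rank}^d(Q)$ = $d$-th largest element of finite $Q\subset\mathbb{Z}$. Write $R=\{q_1<\cdots<q_r\}$, $q_0=0$, $q_{r+1}=n$, $p_h=q_h-q_{h-1}$; carrels $(q_{h-1},q_h]$. $R$-tuples $\nu\in[n]^n$; $UI_R(n)$: tuples with $\nu_i\ge i$ strictly increasing on each carrel. $S_n^R$: permutations $\pi=(\pi_1,\dots,\pi_n)$ of $[n]$ strictly increasing on each carrel; $\pi$ is $R$-312-containing if there exist $h\in[r-1]$ and $a\le q_h<b\le q_{h+1}<c\le n$ with $\pi_b<\pi_c<\pi_a$, else $R$-312-avoiding; $S_n^{R\text{ - }312}$ their set. An $R$-chain is $\emptyset=B_0\subset B_1\subset\cdots\subset B_r\subset B_{r+1}=[n]$ with $|B_h|=q_h$. A clump of a set of integers is a maximal subset of consecutive integers; the chain is $R$-rightmost clump deleting if for each $h\in[r]$, writing $B_{h+1}=L_1\cup\cdots\cup L_f$ as its clumps in increasing order, there is $e\in[f]$ with $L_e\cup\cdots\cup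 L_f\supseteq B_{h+1}\setminus B_h\supseteq L_{e+1}\cup\cdots\cup L_f$. $\Psi_R(\pi)_i=\mathrm{rank}^{q_h-i+1}(B_h)$ for $i\in(q_{h-1},q_h]$. Gapless $R$-tuple: $\gamma\in UI_R(n)$ such that for each $h\in[r]$ with $\gamma_{q_h}>\gamma_{q_h+1}$, $s=\gamma_{q_h}-\gamma_{q_h+1}+1\le p_{h+1}$ and $\gamma_{q_h+t}=\gamma_{q_h}-s+t$, $t=1,\dots,s$; $UG_R(n)$ their set. $\Pi_R(\gamma)=\pi$: $\pi_i=\gamma_i$ on $(0,q_1]$; for $h\in[r]$ let $s=\gamma_{q_h}-\gamma_{q_h+1}+1$ if $\gamma_{q_h}>\gamma_{q_h+1}$ else $0$; $\pi_i=\gamma_i$ on $(q_h+s,q_{h+1}]$ and $\pi_i=\mathrm{rank}^{q_h+s-i+1}([\gamma_{q_h}]\setminus\{\pi_1,\dots,\pi_{q_h}\})$ on $(q_h,q_h+s]$. -}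

module Defs where

open import Data.Nat using (ℕ; zero; suc; _+_; _∸_; _≤_; _<_; _≤ᵇ_; _<ᵇ_; _≡ᵇ_)
open import Data.Bool using (Bool; true; false; if_then_else_; not; _∧_; _∨_)
open import Data.Product using (Σ; _×_; _,_; ∃)
open import Data.Maybe using (Maybe; just; nothing)
open import Data.List using (List; []; _∷_; _++_; length; filter; map; take; drop)
open import Data.List.Relation.Unary.All using (All)
open import Data.List.Relation.Unary.Any using (Any)
open import Data.List.Relation.Unary.Linked using (Linked)
open import Data.Vec as V using (Vec)
open import Data.Fin using (Fin; toℕ)
open import Data.Fin.Subset as S using (Subset; ∣_∣; _⊆_)
open import Relation.Binary.PropositionalEquality using (_≡_)
open import Relation.Nullary using (¬_)

-- Conventions.
-- * Integers / positions are ℕ, 1-indexed as in the paper.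
-- * R ⊆ [n-1] is represented by the strictly increasing list q₁ < … < q_r.
-- * A tuple ν ∈ [n]^n is a  Vec ℕ n ;  ν ! i  is its i-th entry (i ∈ [n]).
-- * A subset of [n] is a  Subset n  (bit j ↔ integer j+1).

get : {A : Set} → A → List A → ℕ → A
get d []       _             = d
get d (x ∷ xs) zero          = d
get d (x ∷ xs) (suc zero)    = x
get d (x ∷ xs) (suc (suc k)) = get d xs (suc k)

_!_ : {n : ℕ} → Vec ℕ n → ℕ → ℕ
ν ! i = get 0 (V.toList ν) i

_∈S_ : {n : ℕ} → ℕ → Subset n → Bool
x ∈S B = get false (V.toList B) x

memb : ℕ → List ℕ → Bool
memb x []       = false
memb x (y ∷ ys) = (x ≡ᵇ y) ∨ memb x ys

desc : ℕ → List ℕ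
desc zero    = []
desc (suc g) = suc g ∷ desc g

-- rank^d of a finite set given by its elements in decreasing order:
-- the d-th largest element (d ≥ 1)
rankL : ℕ → List ℕ → ℕ
rankL d xs = get 0 xs d

elemsDesc : {n : ℕ} → Subset n → List ℕ
elemsDesc {n} B = filter (λ x → (x ∈S B) Data.Bool.≟ true) (desc n)

ValidR : ℕ → List ℕ → Set
ValidR n R = Linked _<_ R × All (λ q → 1 ≤ q × suc q ≤ n) R

-- q n R h = q_h for 0 ≤ h ≤ r+1  (q_0 = 0, q_{r+1} = n)
q : ℕ → List ℕ → ℕ → ℕ
q n R zero    = 0
q n R (suc h) = get n R (suc h)

p : ℕ → List ℕ → ℕ → ℕ
p n R h = q n R h ∸ q n R (h ∸ 1)

-- number of q_h (h ∈ [r]) strictly below i; for i ∈ (q_k, q_{k+1}] this is k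
below : List ℕ → ℕ → ℕ
below R i = length (filter (λ x → x Data.Nat.<? i) R)

IsRTuple : (n : ℕ) → Vec ℕ n → Set
IsRTuple n ν = ∀ i → 1 ≤ i → i ≤ n → 1 ≤ ν ! i × ν ! i ≤ n

CarrelInc : (n : ℕ) → List ℕ → Vec ℕ n → Set
CarrelInc n R ν = ∀ h → 1 ≤ h → h ≤ suc (length R) →
  ∀ i j → q n R (h ∸ 1) < i → i < j → j ≤ q n R h → ν ! i < ν ! j

InUI : (n : ℕ) → List ℕ → Vec ℕ n → Set
InUI n R ν = IsRTuple n ν × (∀ i → 1 ≤ i → i ≤ n → i ≤ ν ! i) × CarrelInc n R ν

InUG : (n : ℕ) → List ℕ → Vec ℕ n → Set
InUG n R γ = InUI n R γ ×
  (∀ h → 1 ≤ h → h ≤ length R →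
     let Q = q n R h
         s = suc (γ ! Q ∸ γ ! suc Q)
     in γ ! suc Q ≤ γ ! Q →
        s ≤ p n R (suc h) × (∀ t → 1 ≤ t → t ≤ s → γ ! (Q + t) ≡ (γ ! Q + t) ∸ s))

IsPerm : (n : ℕ) → Vec ℕ n → Set
IsPerm n π = IsRTuple n π × (∀ i j → 1 ≤ i → i ≤ n → 1 ≤ j → j ≤ n → π ! i ≡ π ! j → i ≡ j)

InSR : (n : ℕ) → List ℕ → Vec ℕ n → Set
InSR n R π = IsPerm n π × CarrelInc n R π

Contains312 : (n : ℕ) → List ℕ → Vec ℕ n → Set
Contains312 n R π = Σ ℕ λ h → Σ ℕ λ a → Σ ℕ λ b → Σ ℕ λ c →
  (1 ≤ h × suc h ≤ length R) ×
  (1 ≤ a × a ≤ q n R h × q n R h < b × b ≤ q n R (suc h) × q n R (suc h) < c × c ≤ n) ×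
  (π ! b < π ! c × π ! c < π ! a)

InSR312 : (n : ℕ) → List ℕ → Vec ℕ n → Set
InSR312 n R π = InSR n R π × ¬ Contains312 n R π

-- Chains: a chain is the list B_1, …, B_r of subsets of [n];
-- B_0 = ∅ and B_{r+1} = [n] are implicit.

Bget : {n : ℕ} → List (Subset n) → ℕ → Subset n
Bget Bs zero    = S.⊥
Bget Bs (suc h) = get S.⊤ Bs (suc h)

IsChain : (n : ℕ) → List ℕ → List (Subset n) → Set
IsChain n R Bs = length Bs ≡ length R ×
  (∀ h → h ≤ length R → Bget Bs h ⊆ Bget Bs (suc h)) ×
  (∀ h → 1 ≤ h → h ≤ length R → ∣ Bget Bs h ∣ ≡ q n R h)

prefixSet : {n : ℕ} → ℕ → Vec ℕ n → Subset n
prefixSet k π = V.tabulate (λ j → memb (suc (toℕ j)) (take k (V.toList π)))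

chainOf : (n : ℕ) → List ℕ → Vec ℕ n → List (Subset n)
chainOf n R π = map (λ qh → prefixSet qh π) R

-- clumps (maximal runs of consecutive integers) of a subset of [n],
-- as intervals [a, b], listed in increasing order.
-- runs k o bs : k is the integer labelling the head of bs; o = just a if a
-- run started at a is still open.
runs : ℕ → Maybe ℕ → List Bool → List (ℕ × ℕ)
runs k nothing  []           = []
runs k (just a) []           = (a , k ∸ 1) ∷ []
runs k nothing  (true ∷ bs)  = runs (suc k) (just k) bs
runs k nothing  (false ∷ bs) = runs (suc k) nothing bs
runs k (just a) (true ∷ bs)  = runs (suc k) (just a) bs
runs k (just a) (false ∷ bs) = (a , k ∸ 1) ∷ runs (suc k) nothing bs

clumps : {n : ℕ} → Subset n → List (ℕ × ℕ)
clumps B = runs 1 nothing (V.toList B)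

InUnion : ℕ → List (ℕ × ℕ) → Set
InUnion x Ls = Any (λ ab → Data.Product.proj₁ ab ≤ x × x ≤ Data.Product.proj₂ ab) Ls

-- R-rightmost clump deleting chains.  With clumps L_1 … L_f of B_{h+1},
-- e ∈ [f] is encoded as e' = e-1 ∈ {0,…,f-1}:  L_e ∪ … ∪ L_f = ⋃ drop e' Ls,
-- L_{e+1} ∪ … ∪ L_f = ⋃ drop (e'+1) Ls.
RCD : (n : ℕ) → List ℕ → List (Subset n) → Set
RCD n R Bs = IsChain n R Bs ×
  (∀ h → 1 ≤ h → h ≤ length R →
     let Ls = clumps (Bget Bs (suc h))
         D  = λ x → (x ∈S Bget Bs (suc h)) ∧ not (x ∈S Bget Bs h)
     in Σ ℕ λ e → e < length Ls ×
          (∀ x → D x ≡ true → InUnion x (drop e Ls)) ×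
          (∀ x → InUnion x (drop (suc e) Ls) → D x ≡ true))

Ψ : (n : ℕ) → List ℕ → Vec ℕ n → Vec ℕ n
Ψ n R π = V.tabulate λ j →
  let i = suc (toℕ j)
      h = suc (below R i)
  in rankL (suc (q n R h) ∸ i) (elemsDesc (prefixSet (q n R h) π))

-- value π_i, given acc = (π_1, …, π_{i-1})
ΠVal : (n : ℕ) → List ℕ → Vec ℕ n → List ℕ → ℕ → ℕ
ΠVal n R γ acc i with below R i
... | zero  = γ ! i
... | suc k =
  let Q  = q n R (suc k)
      g  = γ ! Q
      s  = if γ ! suc Q ≤ᵇ g then suc (g ∸ γ ! suc Q) else 0
      av = filter (λ x → Data.Bool._≟_ (memb x (take Q acc)) false) (desc g)
  in if i ≤ᵇ Q + s then rankL (suc (Q + s) ∸ i) av else γ ! i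

ΠList : (n : ℕ) → List ℕ → Vec ℕ n → ℕ → List ℕ
ΠList n R γ zero    = []
ΠList n R γ (suc i) = let acc = ΠList n R γ i in acc ++ (ΠVal n R γ acc (suc i) ∷ [])

Π : (n : ℕ) → List ℕ → Vec ℕ n → Vec ℕ n
Π n R γ = V.tabulate λ j → get 0 (ΠList n R γ n) (suc (toℕ j))

module Submission where
-- Everything is phrased through chains  B_0 ⊆ B_1 ⊆ … ⊆ B_{r+1}  given by membership tests
-- (Chain), and through the combinatorics of counting on initial segments [1, g] (count, rank).
--   * The prefix chain B_h = {π_1, …, π_{q_h}} of π ∈ S_n^R determines π (chain-inj), and π is
--     R-312-avoiding iff its chain is 312-free: no w < z < x with w ∈ B_{h+1} ∖ B_h, z ∉ B_{h+1},
--     x ∈ B_h (Chain312Free).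
--   * Ψ_R(π) is the rank tuple of that chain: γ_i is the i-th smallest element of the set of the
--     carrel of i (IsRankTuple, rankTuple-isRankTuple).  The rank tuple of any 312-free chain is
--     gapless (RankTuples.rankTuple-gapless).
--   * Conversely, for gapless γ the permutation Π_R(γ) is 312-avoiding, its chain is 312-free and
--     γ is its rank tuple (PiOfGapless); if γ is the rank tuple of a 312-free chain B, then the
--     chain of Π_R(γ) is B itself (Reconstruction).
--   * A chain is rightmost clump deleting iff it is 312-free (ClumpGlue), via a description of the
--     clumps of a set as separated runs.

open import Defs
open import Data.Nat
open import Data.Nat.Properties
open import Data.Nat.Tactic.RingSolver using (solve-∀)
open import Data.Bool using (Bool; true; false; if_then_else_; not; _∧_; _∨_; T)
import Data.Bool as B
import Data.Bool.Properties as BP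
open import Data.Product using (Σ; _×_; _,_; proj₁; proj₂)
open import Data.Sum using (_⊎_; inj₁; inj₂)
open import Data.Empty using (⊥; ⊥-elim)
open import Data.Unit using (⊤; tt)
open import Data.Maybe using (Maybe; just; nothing)
open import Data.List using (List; []; _∷_; _++_; length; filter; map; take; drop)
import Data.List.Properties as LP
open import Data.List.Relation.Unary.Linked using (Linked; [-]) renaming (_∷_ to _∷L_)
open import Data.List.Relation.Unary.All using (All) renaming (_∷_ to _∷A_; [] to []A)
open import Data.List.Relation.Unary.Any using (Any; here; there)
open import Data.Vec as V using (Vec; toList; tabulate; lookup)
import Data.Vec.Properties as VP
open import Data.Fin using (Fin; toℕ; fromℕ<) renaming (zero to fz; suc to fs)
import Data.Fin.Properties as FP
open import Data.Fin.Subset as S using (Subset; ∣_∣; _⊆_)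
open import Relation.Binary.PropositionalEquality
open import Relation.Nullary
open import Relation.Binary using (tri<; tri≈; tri>)

≡ᵇ-refl : ∀ x → (x ≡ᵇ x) ≡ true
≡ᵇ-refl zero = refl
≡ᵇ-refl (suc x) = ≡ᵇ-refl x

≡ᵇ-true : ∀ x y → (x ≡ᵇ y) ≡ true → x ≡ y
≡ᵇ-true x y e = ≡ᵇ⇒≡ x y (subst T (sym e) tt)

≡ᵇ-false : ∀ x y → x ≢ y → (x ≡ᵇ y) ≡ false
≡ᵇ-false x y ne with x ≡ᵇ y in e
... | true = ⊥-elim (ne (≡ᵇ-true x y e))
... | false = refl

≤ᵇ-true : ∀ a b → a ≤ b → (a ≤ᵇ b) ≡ true
≤ᵇ-true a b le with a ≤ᵇ b in e
... | true = refl
... | false = ⊥-elim (subst T e (≤⇒≤ᵇ le))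

≤ᵇ-false : ∀ a b → b < a → (a ≤ᵇ b) ≡ false
≤ᵇ-false a b lt with a ≤ᵇ b in e
... | false = refl
... | true = ⊥-elim (<-irrefl refl (<-≤-trans lt (≤ᵇ⇒≤ a b (subst T (sym e) tt))))

≤ᵇ-false⇒> : ∀ a b → (a ≤ᵇ b) ≡ false → b < a
≤ᵇ-false⇒> a b e with a ≤? b
... | yes le = ⊥-elim (subst T e (≤⇒≤ᵇ le))
... | no nle = ≰⇒> nle

bool-ext : ∀ a b → (a ≡ true → b ≡ true) → (b ≡ true → a ≡ true) → a ≡ b
bool-ext true true f g = refl
bool-ext true false f g = sym (f refl)
bool-ext false true f g = g refl
bool-ext false false f g = refl

not-true : ∀ a → not a ≡ true → a ≡ false
not-true false e = refl

not-false : ∀ a → a ≡ false → not a ≡ true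
not-false false e = refl

∧-true : ∀ a b → (a ∧ b) ≡ true → a ≡ true × b ≡ true
∧-true true true e = refl , refl

∨-true : ∀ a b → (a ∨ b) ≡ true → a ≡ true ⊎ b ≡ true
∨-true true b e = inj₁ refl
∨-true false b e = inj₂ e

≤pred⇒< : ∀ {x k} → 1 ≤ k → x ≤ k ∸ 1 → x < k
≤pred⇒< {x} {suc k} _ le = s≤s le

∸suc' : ∀ {k x} → k < x → x ∸ k ≡ suc (x ∸ suc k)
∸suc' {zero} {suc x} _ = refl
∸suc' {suc k} {suc x} (s≤s lt) = ∸suc' lt

-- Reading off a lower bound for a from a lower bound for a ∸ b (no hypothesis b ≤ a needed).
∸-split : ∀ a b c → suc c ≤ a ∸ b → b + suc c ≤ a
∸-split a b c le with b ≤? a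
... | yes ba = subst (b + suc c ≤_) (m+[n∸m]≡n ba) (+-monoʳ-≤ b le)
... | no nba with subst (suc c ≤_) (m≤n⇒m∸n≡0 (<⇒≤ (≰⇒> nba))) le
...   | ()

pos-of-+ : ∀ Q s Q' → Q + s ≡ Q' → Q < Q' → 1 ≤ s
pos-of-+ Q zero Q' e lt = ⊥-elim (<-irrefl (trans (sym (+-identityʳ Q)) e) lt)
pos-of-+ Q (suc s) Q' e lt = s≤s z≤n

+-trade-< : ∀ a b c d → a + c ≡ b + d → b < a → c < d
+-trade-< a b c d e lt with c <? d
... | yes p = p
... | no np = ⊥-elim (<-irrefl (sym e) (+-mono-<-≤ lt (≮⇒≥ np)))

+-swap : ∀ Q u t → Q + (u + t) ≡ u + (Q + t)
+-swap = solve-∀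

-- Index arithmetic for a block of s positions (Q, Q + s]: position i is addressed by the
-- rank index (Q + s) ∸ i < s, the first position by s − 1, and rank index D < s by a position > Q.
rankIndex<shift : ∀ Q s i → Q < i → i ≤ Q + s → suc ((Q + s) ∸ i) ≤ s
rankIndex<shift Q s i a b = subst (suc ((Q + s) ∸ i) ≤_) (m+n∸m≡n Q s) (∸-monoʳ-< {Q + s} {i} {Q} a b)

shift-firstIndex : ∀ Q s → 1 ≤ s → suc ((Q + s) ∸ suc Q) ≡ s
shift-firstIndex Q (suc s) _ = cong suc (trans (cong (_∸ suc Q) (+-suc Q s)) (m+n∸m≡n Q s))

<-shiftIndex : ∀ Q s D → D < s → Q < (Q + s) ∸ D
<-shiftIndex Q s D lt = subst (Q <_) (sym (+-∸-assoc Q (<⇒≤ lt))) (subst (_≤ Q + (s ∸ D)) (+-comm Q 1) (+-monoʳ-≤ Q (m<n⇒0<n∸m lt)))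

min-aux : ∀ (f : ℕ → Bool) w → (∀ u → u ≤ w → f u ≡ false) ⊎ (Σ ℕ λ w0 → f w0 ≡ true × (∀ u → u < w0 → f u ≡ false))
min-aux f zero with f 0 in e
... | true = inj₂ (0 , e , λ u ())
... | false = inj₁ (λ { zero _ → e })
min-aux f (suc w) with min-aux f w
... | inj₂ x = inj₂ x
... | inj₁ all with f (suc w) in e
...   | true = inj₂ (suc w , e , λ u lt → all u (≤-pred lt))
...   | false = inj₁ (λ u le → case (m≤n⇒m<n∨m≡n le))
  where
  case : ∀ {u} → u < suc w ⊎ u ≡ suc w → f u ≡ false
  case (inj₁ lt) = all _ (≤-pred lt)
  case (inj₂ refl) = e

min-find : ∀ (f : ℕ → Bool) w → f w ≡ true → Σ ℕ λ w0 → f w0 ≡ true × (∀ u → u < w0 → f u ≡ false)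
min-find f w e with min-aux f w
... | inj₂ x = x
... | inj₁ all with trans (sym e) (all w ≤-refl)
...   | ()

-- Counting on initial segments.  count f g = #{x ∈ [1, g] | f x}, and  rank f g d  is the
-- (d+1)-th largest such x, read off the decreasing enumeration of [g] as in the definition of rank^d.

filterᵇ : (ℕ → Bool) → List ℕ → List ℕ
filterᵇ f = filter (λ x → f x B.≟ true)

count : (ℕ → Bool) → ℕ → ℕ
count f zero = 0
count f (suc g) = if f (suc g) then suc (count f g) else count f g

count-in : ∀ f g → f (suc g) ≡ true → count f (suc g) ≡ suc (count f g)
count-in f g e rewrite e = refl

count-out : ∀ f g → f (suc g) ≡ false → count f (suc g) ≡ count f g
count-out f g e rewrite e = refl

filter-false : ∀ (f : ℕ → Bool) xs → filter (λ x → f x B.≟ false) xs ≡ filterᵇ (λ x → not (f x)) xs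
filter-false f [] = refl
filter-false f (x ∷ xs) with f x
... | true = filter-false f xs
... | false = cong (x ∷_) (filter-false f xs)

rank : (ℕ → Bool) → ℕ → ℕ → ℕ
rank f g d = get 0 (filterᵇ f (desc g)) (suc d)

rank-spec : ∀ f g d → suc d ≤ count f g →
  f (rank f g d) ≡ true × 1 ≤ rank f g d × rank f g d ≤ g × count f g ≡ d + count f (rank f g d)
rank-spec f zero d ()
rank-spec f (suc g) d le with f (suc g) in eq
... | true with d
...   | zero rewrite count-in f g eq = eq , s≤s z≤n , ≤-refl , refl
...   | suc d' with rank-spec f g d' (≤-pred le)
...     | a , b , c , e = a , b , m≤n⇒m≤1+n c , cong suc e
rank-spec f (suc g) d le | false with rank-spec f g d le
... | a , b , c , e = a , b , m≤n⇒m≤1+n c , e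

count-≤ : ∀ f g → count f g ≤ g
count-≤ f zero = z≤n
count-≤ f (suc g) with f (suc g)
... | true = s≤s (count-≤ f g)
... | false = m≤n⇒m≤1+n (count-≤ f g)

count-step : ∀ f g → count f g ≤ count f (suc g)
count-step f g with f (suc g)
... | true = n≤1+n _
... | false = ≤-refl

count-step≤1 : ∀ f g → count f (suc g) ≤ suc (count f g)
count-step≤1 f g with f (suc g)
... | true = ≤-refl
... | false = n≤1+n _

count-mono : ∀ f {x y} → x ≤ y → count f x ≤ count f y
count-mono f {x} {zero} z≤n = ≤-refl
count-mono f {x} {suc y} le with m≤n⇒m<n∨m≡n le
... | inj₂ refl = ≤-refl
... | inj₁ (s≤s lt) = ≤-trans (count-mono f lt) (count-step f y)

count-strict : ∀ f {x y} → f y ≡ true → x < y → count f x < count f y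
count-strict f {x} {suc y} e (s≤s le) rewrite count-in f y e = s≤s (count-mono f le)

count-pos : ∀ f {x} → f x ≡ true → 1 ≤ x → 1 ≤ count f x
count-pos f {suc x} e _ rewrite count-in f x e = s≤s z≤n

count-injective : ∀ f {x y} → f x ≡ true → f y ≡ true → count f x ≡ count f y → x ≡ y
count-injective f {x} {y} ex ey c with <-cmp x y
... | tri< a _ _ = ⊥-elim (<-irrefl c (count-strict f ey a))
... | tri≈ _ b _ = b
... | tri> _ _ a = ⊥-elim (<-irrefl (sym c) (count-strict f ex a))

count-reflect-< : ∀ f x y → count f x < count f y → x < y
count-reflect-< f x y lt with x <? y
... | yes p = p
... | no np = ⊥-elim (<-irrefl refl (<-≤-trans lt (count-mono f (≮⇒≥ np))))

rank-unique : ∀ f g d x → f x ≡ true → 1 ≤ x → x ≤ g → count f g ≡ d + count f x → rank f g d ≡ x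
rank-unique f g d x fx x1 xg c with rank-spec f g d (subst (suc d ≤_) (sym c)
   (subst (_≤ d + count f x) (+-comm d 1) (+-monoʳ-≤ d (count-pos f fx x1))))
... | a , b , _ , e = count-injective f a fx (+-cancelˡ-≡ d _ _ (trans (sym e) c))

count-ext : ∀ f f' g → (∀ y → 1 ≤ y → y ≤ g → f y ≡ f' y) → count f g ≡ count f' g
count-ext f f' zero h = refl
count-ext f f' (suc g) h with f (suc g) | f' (suc g) | h (suc g) (s≤s z≤n) ≤-refl
... | true | true | _ = cong suc (count-ext f f' g (λ y a b → h y a (m≤n⇒m≤1+n b)))
... | false | false | _ = count-ext f f' g (λ y a b → h y a (m≤n⇒m≤1+n b))

count-true : ∀ g → count (λ _ → true) g ≡ g
count-true zero = refl
count-true (suc g) = cong suc (count-true g)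

count-none : ∀ f x → (∀ w → 1 ≤ w → w ≤ x → f w ≡ false) → count f x ≡ 0
count-none f zero h = refl
count-none f (suc x) h = trans (count-out f x (h (suc x) (s≤s z≤n) ≤-refl)) (count-none f x (λ w a b → h w a (m≤n⇒m≤1+n b)))

count-const : ∀ f X m → X ≤ m → (∀ y → X < y → y ≤ m → f y ≡ false) → count f m ≡ count f X
count-const f X m le h with m≤n⇒m<n∨m≡n le
... | inj₂ refl = refl
count-const f X (suc m) le h | inj₁ (s≤s lt) =
  trans (count-out f m (h (suc m) (s≤s lt) ≤-refl)) (count-const f X m lt (λ y a b → h y a (m≤n⇒m≤1+n b)))

count-not : ∀ f g → count (λ x → not (f x)) g + count f g ≡ g
count-not f zero = refl
count-not f (suc g) with f (suc g)
... | true = trans (+-suc _ _) (cong suc (count-not f g))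
... | false = cong suc (count-not f g)

count-≤-interval : ∀ f a b → a ≤ b → count f b ≤ (b ∸ a) + count f a
count-≤-interval f a b le with m≤n⇒m<n∨m≡n le
... | inj₂ refl = subst (λ k → count f a ≤ k + count f a) (sym (n∸n≡0 a)) ≤-refl
count-≤-interval f a (suc b) le | inj₁ (s≤s lt) =
  ≤-trans (count-step≤1 f b) (subst (suc (count f b) ≤_) (cong (_+ count f a) (sym (+-∸-assoc 1 lt))) (s≤s (count-≤-interval f a b lt)))

count-run : ∀ f y k → (∀ z → y ≤ z → z ≤ y + k → f z ≡ true) → count f (y + k) ≡ k + count f y
count-run f y zero h = cong (count f) (+-identityʳ y)
count-run f y (suc k) h rewrite +-suc y k =
  trans (count-in f (y + k) (h (suc (y + k)) (≤-trans (m≤m+n y k) (n≤1+n _)) ≤-refl))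
        (cong suc (count-run f y k (λ z a b → h z a (≤-trans b (n≤1+n _)))))

rank-room : ∀ f v M d → f v ≡ true → f M ≡ false → 1 ≤ v → v ≤ M → count f M ≡ d + count f v → suc d + v ≤ M
rank-room f (suc u) zero d fv fM v1 () e
rank-room f v (suc M') d fv fM v1 vM e with m≤n⇒m<n∨m≡n vM
... | inj₂ refl with trans (sym fv) fM
...   | ()
rank-room f v (suc M') d fv fM v1 vM e | inj₁ (s≤s vM') = s≤s (subst (_≤ M') (+-comm v d) (subst (v + d ≤_) (m+[n∸m]≡n vM') (+-monoʳ-≤ v dle)))
  where
  le1 : d + count f v ≤ (M' ∸ v) + count f v
  le1 = subst (_≤ (M' ∸ v) + count f v) (trans (sym (count-out f M' fM)) e) (count-≤-interval f v M' vM')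
  dle : d ≤ M' ∸ v
  dle = +-cancelʳ-≤ (count f v) d (M' ∸ v) le1

Incl : (ℕ → Bool) → (ℕ → Bool) → ℕ → Set
Incl f f' g = ∀ y → 1 ≤ y → y ≤ g → f y ≡ true → f' y ≡ true

Incl-pred : ∀ {f f' g} → Incl f f' (suc g) → Incl f f' g
Incl-pred h y a b = h y a (m≤n⇒m≤1+n b)

count-incl : ∀ f f' g → Incl f f' g → count f g ≤ count f' g
count-incl f f' zero h = z≤n
count-incl f f' (suc g) h with f (suc g) in e1 | f' (suc g) in e2
... | true | true = s≤s (count-incl f f' g (Incl-pred h))
... | false | true = m≤n⇒m≤1+n (count-incl f f' g (Incl-pred h))
... | false | false = count-incl f f' g (Incl-pred h)
... | true | false with trans (sym (h (suc g) (s≤s z≤n) ≤-refl e1)) e2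
... | ()

count-witness : ∀ f f' g → Incl f f' g → count f g < count f' g →
  Σ ℕ λ w → 1 ≤ w × w ≤ g × f' w ≡ true × f w ≡ false
count-witness f f' zero h ()
count-witness f f' (suc g) h lt with f (suc g) in e1 | f' (suc g) in e2
... | false | true = suc g , s≤s z≤n , ≤-refl , e2 , e1
... | true | true with count-witness f f' g (Incl-pred h) (≤-pred lt)
...   | w , a , b , c , d = w , a , m≤n⇒m≤1+n b , c , d
count-witness f f' (suc g) h lt | false | false with count-witness f f' g (Incl-pred h) lt
...   | w , a , b , c , d = w , a , m≤n⇒m≤1+n b , c , d
count-witness f f' (suc g) h lt | true | false with trans (sym (h (suc g) (s≤s z≤n) ≤-refl e1)) e2
... | ()

count-incl-strict : ∀ f f' g → Incl f f' g → ∀ y → 1 ≤ y → y ≤ g → f' y ≡ true → f y ≡ false → count f g < count f' g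
count-incl-strict f f' zero h (suc y) a () e' e
count-incl-strict f f' (suc g) h y a b e' e with m≤n⇒m<n∨m≡n b
... | inj₂ refl rewrite count-in f' g e' | count-out f g e = s≤s (count-incl f f' g (Incl-pred h))
... | inj₁ (s≤s b') with count-incl-strict f f' g (Incl-pred h) y a b' e' e | f (suc g) in e1 | f' (suc g) in e2
...   | r | true | true = s≤s r
...   | r | false | false = r
...   | r | false | true = m≤n⇒m≤1+n r
...   | r | true | false with trans (sym (h (suc g) (s≤s z≤n) ≤-refl e1)) e2
...     | ()

count-incl-eq : ∀ f f' g → Incl f f' g → count f g ≡ count f' g → Incl f' f g
count-incl-eq f f' g h c y a b e' with f y in e
... | true = refl
... | false = ⊥-elim (<-irrefl c (count-incl-strict f f' g h y a b e' e))

count-split : ∀ g g' m → Incl g g' m → count g' m ≡ count g m + count (λ x → g' x ∧ not (g x)) m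
count-split g g' zero S = refl
count-split g g' (suc m) S with g (suc m) in e1 | g' (suc m) in e2 | count-split g g' m (Incl-pred S)
... | true | true | ih = cong suc ih
... | false | true | ih = trans (cong suc ih) (sym (+-suc _ _))
... | false | false | ih = ih
... | true | false | ih with trans (sym (S (suc m) (s≤s z≤n) ≤-refl e1)) e2
...   | ()

count-incl-interval : ∀ f A M x → Incl f A M → x ≤ M → count f M + count A x ≤ count A M + count f x
count-incl-interval f A M x S le with m≤n⇒m<n∨m≡n le
... | inj₂ refl = ≤-reflexive (+-comm (count f x) (count A x))
count-incl-interval f A (suc M) x S le | inj₁ (s≤s lt) with f (suc M) in e1 | A (suc M) in e2 | count-incl-interval f A M x (Incl-pred S) lt
... | true | true | ih = s≤s ih
... | false | true | ih = m≤n⇒m≤1+n ih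
... | false | false | ih = ih
... | true | false | ih with trans (sym (S (suc M) (s≤s z≤n) ≤-refl e1)) e2
...   | ()

qList : ℕ → List ℕ → List ℕ
qList n R = 0 ∷ R ++ n ∷ []

get-pad : ∀ (n : ℕ) (R : List ℕ) h → get n R (suc h) ≡ get n (R ++ n ∷ []) (suc h)
get-pad n [] zero = refl
get-pad n [] (suc h) = refl
get-pad n (a ∷ R) zero = refl
get-pad n (a ∷ R) (suc h) = get-pad n R h

q-get : ∀ n R h → q n R h ≡ get n (qList n R) (suc h)
q-get n R zero = refl
q-get n R (suc h) = get-pad n R h

length-qList : ∀ n R → length (qList n R) ≡ suc (suc (length R))
length-qList n R = cong suc (trans (LP.length-++ R) (+-comm (length R) 1))

linked-head-≤ : ∀ d x xs k → Linked _<_ (x ∷ xs) → k < length (x ∷ xs) → x ≤ get d (x ∷ xs) (suc k)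
linked-head-≤ d x xs zero L lt = ≤-refl
linked-head-≤ d x (y ∷ ys) (suc k) (xy ∷L L) (s≤s lt) = ≤-trans (<⇒≤ xy) (linked-head-≤ d y ys k L lt)

linked-get-mono : ∀ d xs → Linked _<_ xs → ∀ h h' → h < h' → h' < length xs → get d xs (suc h) < get d xs (suc h')
linked-get-mono d (x ∷ y ∷ ys) (xy ∷L L) zero (suc k) lt (s≤s lt') = <-≤-trans xy (linked-head-≤ d y ys k L lt')
linked-get-mono d (x ∷ y ∷ ys) (xy ∷L L) (suc a) (suc b) (s≤s lt) (s≤s lt') = linked-get-mono d (y ∷ ys) L a b lt lt'
linked-get-mono d (x ∷ []) [-] zero (suc k) lt (s≤s ())
linked-get-mono d (x ∷ []) [-] (suc a) (suc b) lt (s≤s ())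

linked-append : ∀ n R → Linked _<_ R → All (λ x → 1 ≤ x × suc x ≤ n) R → Linked _<_ (R ++ n ∷ [])
linked-append n [] L A = [-]
linked-append n (a ∷ []) [-] ((_ , an) ∷A []A) = an ∷L [-]
linked-append n (a ∷ b ∷ R) (ab ∷L L) (_ ∷A A) = ab ∷L linked-append n (b ∷ R) L A

linked-qList : ∀ n R → 1 ≤ n → ValidR n R → Linked _<_ (qList n R)
linked-qList n [] n1 (L , A) = n1 ∷L [-]
linked-qList n (a ∷ R) n1 (L , A@((a1 , _) ∷A _)) = a1 ∷L linked-append n (a ∷ R) L A

q-mono : ∀ n R → 1 ≤ n → ValidR n R → ∀ h h' → h < h' → h' ≤ suc (length R) → q n R h < q n R h'
q-mono n R n1 V h h' lt le rewrite q-get n R h | q-get n R h' =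
  linked-get-mono n (qList n R) (linked-qList n R n1 V) h h' lt (subst (h' <_) (sym (length-qList n R)) (s≤s le))

q-mono-≤ : ∀ n R → 1 ≤ n → ValidR n R → ∀ h h' → h ≤ h' → h' ≤ suc (length R) → q n R h ≤ q n R h'
q-mono-≤ n R n1 V h h' le le' with m≤n⇒m<n∨m≡n le
... | inj₁ lt = <⇒≤ (q-mono n R n1 V h h' lt le')
... | inj₂ refl = ≤-refl

q-last : ∀ n R → q n R (suc (length R)) ≡ n
q-last n [] = refl
q-last n (a ∷ R) = q-last n R

q-≤n : ∀ n R → 1 ≤ n → ValidR n R → ∀ h → h ≤ suc (length R) → q n R h ≤ n
q-≤n n R n1 V h le = subst (q n R h ≤_) (q-last n R) (q-mono-≤ n R n1 V h _ le ≤-refl)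

below-zero : ∀ n a R' i → Linked _<_ (a ∷ R' ++ n ∷ []) → i ≤ a → below R' i ≡ 0
below-zero n a [] i L le = refl
below-zero n a (c ∷ R') i (ac ∷L L) le with c <ᵇ i in e
... | true = ⊥-elim (<-irrefl refl (<-trans (<ᵇ⇒< c i (subst T (sym e) _)) (≤-<-trans le ac)))
... | false = below-zero n c R' i L (≤-trans le (<⇒≤ ac))

below-bounds : ∀ n b R i → Linked _<_ (b ∷ R ++ n ∷ []) → b < i → i ≤ n →
  get n (b ∷ R ++ n ∷ []) (suc (below R i)) < i × i ≤ get n (b ∷ R ++ n ∷ []) (suc (suc (below R i))) × below R i ≤ length R
below-bounds n b [] i L bi i≤n = bi , i≤n , z≤n
below-bounds n b (a ∷ R) i (ba ∷L L) bi i≤n with a <ᵇ i in e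
... | true with below-bounds n a R i L (<ᵇ⇒< a i (subst T (sym e) _)) i≤n
...   | x , y , z = x , y , s≤s z
below-bounds n b (a ∷ R) i (ba ∷L L) bi i≤n | false rewrite below-zero n a R i L (≮⇒≥ λ ai → subst T e (<⇒<ᵇ ai)) = bi , ≮⇒≥ (λ ai → subst T e (<⇒<ᵇ ai)) , z≤n

carrel-of : ∀ n R → 1 ≤ n → ValidR n R → ∀ i → 1 ≤ i → i ≤ n →
  q n R (below R i) < i × i ≤ q n R (suc (below R i)) × below R i ≤ length R
carrel-of n R n1 V i i1 i≤n with below-bounds n 0 R i (linked-qList n R n1 V) i1 i≤n
... | x , y , z rewrite sym (q-get n R (below R i)) | sym (q-get n R (suc (below R i))) = x , y , z

below-unique : ∀ n R → 1 ≤ n → ValidR n R → ∀ i h → h ≤ length R → q n R h < i → i ≤ q n R (suc h) → below R i ≡ h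
below-unique n R n1 V i h hr a b with carrel-of n R n1 V i (≤-trans (s≤s z≤n) a) (≤-trans b (q-≤n n R n1 V (suc h) (s≤s hr)))
... | x , y , z with <-cmp (below R i) h
... | tri≈ _ e _ = e
... | tri< lt _ _ = ⊥-elim (<-irrefl refl (≤-<-trans (≤-trans y (q-mono-≤ n R n1 V (suc (below R i)) h lt (m≤n⇒m≤1+n hr))) a))
... | tri> _ _ gt = ⊥-elim (<-irrefl refl (<-≤-trans x (≤-trans b (q-mono-≤ n R n1 V (suc h) (below R i) gt (m≤n⇒m≤1+n z)))))

get-0 : ∀ {A : Set} (d : A) (l : List A) → get d l 0 ≡ d
get-0 d [] = refl
get-0 d (x ∷ l) = refl

get-beyond : ∀ {A : Set} (d : A) (l : List A) k → length l < k → get d l k ≡ d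
get-beyond d [] zero lt = refl
get-beyond d [] (suc k) lt = refl
get-beyond d (x ∷ l) (suc zero) (s≤s ())
get-beyond d (x ∷ l) (suc (suc k)) (s≤s lt) = get-beyond d l (suc k) lt

get-tab : ∀ {A : Set} (d : A) n (F : ℕ → A) i → 1 ≤ i → i ≤ n →
  get d (toList (tabulate {n = n} (λ j → F (suc (toℕ j))))) i ≡ F i
get-tab d (suc n) F (suc zero) a b = refl
get-tab d (suc n) F (suc (suc i)) a (s≤s b) = get-tab d n (λ k → F (suc k)) (suc i) (s≤s z≤n) b

get-rep : ∀ {A : Set} (d a : A) n i → 1 ≤ i → i ≤ n → get d (toList (V.replicate n a)) i ≡ a
get-rep d a (suc n) (suc zero) _ _ = refl
get-rep d a (suc n) (suc (suc i)) _ (s≤s b) = get-rep d a n (suc i) (s≤s z≤n) b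

get-map : ∀ {A B : Set} (f : A → B) (d : B) (d' : A) (L : List A) k → suc k ≤ length L → get d (map f L) (suc k) ≡ f (get d' L (suc k))
get-map f d d' (x ∷ L) zero _ = refl
get-map f d d' (x ∷ L) (suc k) (s≤s le) = get-map f d d' L k le

get-lookup : ∀ {A : Set} (d : A) {n} (v : Vec A n) (x : Fin n) → get d (toList v) (suc (toℕ x)) ≡ lookup v x
get-lookup d (a V.∷ v) fz = refl
get-lookup d (a V.∷ v) (fs x) = get-lookup d v x

get-lookup' : ∀ {A : Set} (d : A) {n} (v : Vec A n) k (lt : k < n) → get d (toList v) (suc k) ≡ lookup v (fromℕ< lt)
get-lookup' d v k lt = subst (λ m → get d (toList v) (suc m) ≡ lookup v (fromℕ< lt)) (FP.toℕ-fromℕ< lt) (get-lookup d v (fromℕ< lt))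

get-++ˡ : ∀ {A : Set} (d : A) (xs ys : List A) j → j ≤ length xs → get d (xs ++ ys) j ≡ get d xs j
get-++ˡ d [] ys zero le = get-0 d ys
get-++ˡ d (x ∷ xs) ys zero le = refl
get-++ˡ d (x ∷ xs) ys (suc zero) le = refl
get-++ˡ d (x ∷ xs) ys (suc (suc j)) (s≤s le) = get-++ˡ d xs ys (suc j) le

get-snoc : ∀ {A : Set} (d : A) (xs : List A) y → get d (xs ++ y ∷ []) (suc (length xs)) ≡ y
get-snoc d [] y = refl
get-snoc d (x ∷ []) y = refl
get-snoc d (x ∷ x' ∷ xs) y = get-snoc d (x' ∷ xs) y

len-toList : ∀ {A : Set} {n} (v : Vec A n) → length (toList v) ≡ n
len-toList V.[] = refl
len-toList (x V.∷ v) = cong suc (len-toList v)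

take-++ˡ : ∀ {A : Set} k (xs ys : List A) → k ≤ length xs → take k (xs ++ ys) ≡ take k xs
take-++ˡ zero xs ys le = refl
take-++ˡ (suc k) (x ∷ xs) ys (s≤s le) = cong (x ∷_) (take-++ˡ k xs ys le)

take-suc : ∀ {A : Set} (d : A) k (l : List A) → k < length l → take (suc k) l ≡ take k l ++ get d l (suc k) ∷ []
take-suc d zero (x ∷ l) lt = refl
take-suc d (suc k) (x ∷ l) (s≤s lt) = cong (x ∷_) (take-suc d k l lt)

list-ext : ∀ {A : Set} (d : A) (l l' : List A) → length l ≡ length l' →
  (∀ j → 1 ≤ j → j ≤ length l → get d l j ≡ get d l' j) → l ≡ l'
list-ext d [] [] e h = refl
list-ext d (x ∷ l) (y ∷ l') e h = cong₂ _∷_ (h 1 ≤-refl (s≤s z≤n))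
  (list-ext d l l' (suc-injective e) (λ { (suc j) a b → h (suc (suc j)) (s≤s z≤n) (s≤s b) }))

vec-ext : ∀ {n} (u v : Vec ℕ n) → (∀ i → 1 ≤ i → i ≤ n → u ! i ≡ v ! i) → u ≡ v
vec-ext V.[] V.[] h = refl
vec-ext (x V.∷ xs) (y V.∷ ys) h = cong₂ V._∷_ (h 1 ≤-refl (s≤s z≤n))
  (vec-ext xs ys (λ { (suc i) a b → h (suc (suc i)) (s≤s z≤n) (s≤s b) }))

bvec-ext : ∀ {n} (u v : Subset n) → (∀ x → 1 ≤ x → x ≤ n → (x ∈S u) ≡ (x ∈S v)) → u ≡ v
bvec-ext V.[] V.[] h = refl
bvec-ext (x V.∷ xs) (y V.∷ ys) h = cong₂ V._∷_ (h 1 ≤-refl (s≤s z≤n))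
  (bvec-ext xs ys (λ { (suc i) a b → h (suc (suc i)) (s≤s z≤n) (s≤s b) }))

∈S-⊤ : ∀ {n} x → 1 ≤ x → x ≤ n → (x ∈S S.⊤ {n}) ≡ true
∈S-⊤ {n} x a b = get-rep false true n x a b

∈S-⊥ : ∀ {n} x → (x ∈S S.⊥ {n}) ≡ false
∈S-⊥ {n} zero = get-0 false (toList (V.replicate n false))
∈S-⊥ {n} (suc x) with x <? n
... | yes lt = get-rep false false n (suc x) (s≤s z≤n) lt
... | no nlt = get-beyond false (toList (V.replicate n false)) (suc x) (subst (_< suc x) (sym (len-toList (V.replicate n false))) (s≤s (≮⇒≥ nlt)))

∈S-range : ∀ {n} (B : Subset n) x → (x ∈S B) ≡ true → 1 ≤ x × x ≤ n
∈S-range {n} B zero e rewrite get-0 false (toList B) with e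
... | ()
∈S-range {n} B (suc x) e with suc x ≤? n
... | yes le = s≤s z≤n , le
... | no nle rewrite get-beyond false (toList B) (suc x) (subst (_< suc x) (sym (len-toList B)) (≰⇒> nle)) with e
... | ()

⊆-from : ∀ {n} (A B : Subset n) → (∀ x → (x ∈S A) ≡ true → (x ∈S B) ≡ true) → A ⊆ B
⊆-from A B h {x} xA = VP.lookup⇒[]= x B
  (trans (sym (get-lookup false B x)) (h (suc (toℕ x)) (trans (get-lookup false A x) (VP.[]=⇒lookup xA))))

⊆-to : ∀ {n} (A B : Subset n) → A ⊆ B → ∀ x → (x ∈S A) ≡ true → (x ∈S B) ≡ true
⊆-to {n} A B h (suc k) e with ∈S-range A (suc k) e
... | _ , le = trans (get-lookup' false B k le)
     (VP.[]=⇒lookup (h (VP.lookup⇒[]= (fromℕ< le) A (trans (sym (get-lookup' false A k le)) e))))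
⊆-to {n} A B h zero e rewrite get-0 false (toList A) with e
... | ()

count-shift : ∀ f m → count f (suc m) ≡ (if f 1 then suc (count (λ x → f (suc x)) m) else count (λ x → f (suc x)) m)
count-shift f zero with f 1
... | true = refl
... | false = refl
count-shift f (suc m) with f (suc (suc m)) in e | count-shift f m
... | true | ih with f 1
...   | true = cong suc ih
...   | false = cong suc ih
count-shift f (suc m) | false | ih with f 1
...   | true = ih
...   | false = ih

card-count : ∀ {n} (B : Subset n) → ∣ B ∣ ≡ count (λ x → x ∈S B) n
card-count {zero} V.[] = refl
card-count {suc n} (b V.∷ B) = trans (lem b) (sym (count-shift (λ x → x ∈S (b V.∷ B)) n))
  where
  ext : count (λ x → x ∈S B) n ≡ count (λ x → (suc x) ∈S (b V.∷ B)) n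
  ext = count-ext _ _ n (λ { (suc y) _ _ → refl })
  lem : ∀ b' → ∣ b' V.∷ B ∣ ≡ (if b' then suc (count (λ x → (suc x) ∈S (b V.∷ B)) n) else count (λ x → (suc x) ∈S (b V.∷ B)) n)
  lem true = cong suc (trans (card-count B) ext)
  lem false = trans (card-count B) ext

memb-take-witness : ∀ x k l → memb x (take k l) ≡ true → Σ ℕ λ j → 1 ≤ j × j ≤ k × j ≤ length l × get 0 l j ≡ x
memb-take-witness x zero l ()
memb-take-witness x (suc k) [] ()
memb-take-witness x (suc k) (y ∷ l) e with ∨-true (x ≡ᵇ y) _ e
... | inj₁ e' = 1 , ≤-refl , s≤s z≤n , s≤s z≤n , sym (≡ᵇ-true x y e')
... | inj₂ e' with memb-take-witness x k l e'
...   | suc j , a , b , c , d = suc (suc j) , s≤s z≤n , s≤s b , s≤s c , d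

memb-take-at : ∀ j k l → 1 ≤ j → j ≤ k → j ≤ length l → memb (get 0 l j) (take k l) ≡ true
memb-take-at (suc zero) (suc k) (y ∷ l) a b c rewrite ≡ᵇ-refl y = refl
memb-take-at (suc (suc j)) (suc k) (y ∷ l) a (s≤s b) (s≤s c) rewrite memb-take-at (suc j) k l (s≤s z≤n) b c
  with y ≡ᵇ y
... | _ = BP.∨-zeroʳ _

memb-++ : ∀ x xs ys → memb x (xs ++ ys) ≡ (memb x xs ∨ memb x ys)
memb-++ x [] ys = refl
memb-++ x (y ∷ xs) ys rewrite memb-++ x xs ys = sym (BP.∨-assoc (x ≡ᵇ y) _ _)

memb-snoc : ∀ x xs y → memb x (xs ++ y ∷ []) ≡ (memb x xs ∨ (x ≡ᵇ y))
memb-snoc x xs y rewrite memb-++ x xs (y ∷ []) = cong (memb x xs ∨_) (BP.∨-identityʳ (x ≡ᵇ y))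

InPrefix : List ℕ → ℕ → ℕ → Bool
InPrefix l k x = memb x (take k l)

InPrefix-mono : ∀ l k k' → k ≤ k' → ∀ x → InPrefix l k x ≡ true → InPrefix l k' x ≡ true
InPrefix-mono l k k' le x e with memb-take-witness x k l e
... | j , a , b , c , d = subst (λ y → InPrefix l k' y ≡ true) d (memb-take-at j k' l a (≤-trans b le) c)

InRange : ℕ → List ℕ → ℕ → Set
InRange n l k = ∀ j → 1 ≤ j → j ≤ k → 1 ≤ get 0 l j × get 0 l j ≤ n

Distinct : List ℕ → ℕ → Set
Distinct l k = ∀ j j' → 1 ≤ j → j ≤ k → 1 ≤ j' → j' ≤ k → get 0 l j ≡ get 0 l j' → j ≡ j'

count-insert : ∀ f y g → f y ≡ false → 1 ≤ y → y ≤ g → count (λ x → f x ∨ (x ≡ᵇ y)) g ≡ suc (count f g)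
count-insert f (suc y) zero fy a ()
count-insert f y (suc g) fy a b with m≤n⇒m<n∨m≡n b
... | inj₂ refl rewrite fy | ≡ᵇ-refl y =
      cong suc (count-ext _ _ g (λ z z1 zg → trans (cong (f z ∨_) (≡ᵇ-false z (suc g) (λ e → <-irrefl e (s≤s zg))))
                                                  (BP.∨-identityʳ (f z))))
... | inj₁ (s≤s lt) with count-insert f y g fy a lt | f (suc g) in e
...   | ih | true = cong suc ih
...   | ih | false rewrite ≡ᵇ-false (suc g) y (λ e → <-irrefl (sym e) (s≤s lt)) = ih

card-prefix : ∀ n l k → k ≤ length l → (∀ j → 1 ≤ j → j ≤ k → 1 ≤ get 0 l j × get 0 l j ≤ n) →
  Distinct l k → count (λ x → memb x (take k l)) n ≡ k
card-prefix n l zero le rng D = count-none _ n (λ _ _ _ → refl)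
card-prefix n l (suc k) le rng D =
  trans (count-ext _ _ n (λ x _ _ → trans (cong (memb x) (take-suc 0 k l le)) (memb-snoc x (take k l) _)))
   (trans (count-insert _ _ n fresh (proj₁ (rng (suc k) (s≤s z≤n) ≤-refl)) (proj₂ (rng (suc k) (s≤s z≤n) ≤-refl)))
     (cong suc (card-prefix n l k (<⇒≤ le) (λ j a b → rng j a (m≤n⇒m≤1+n b))
        (λ j j' a b c d e → D j j' a (m≤n⇒m≤1+n b) c (m≤n⇒m≤1+n d) e))))
  where
  fresh : memb (get 0 l (suc k)) (take k l) ≡ false
  fresh with memb (get 0 l (suc k)) (take k l) in e
  ... | false = refl
  ... | true with memb-take-witness _ k l e
  ...   | j , a , b , c , d = ⊥-elim (<-irrefl (D j (suc k) a (m≤n⇒m≤1+n b) (s≤s z≤n) ≤-refl d) (s≤s b))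

count-InPrefix : ∀ n l m m' X → m ≤ m' → m' ≤ length l → X ≤ n → InRange n l m' → Distinct l m' →
  (∀ j → 1 ≤ j → j ≤ m → get 0 l j ≤ X) → (∀ j → m < j → j ≤ m' → X < get 0 l j) →
  count (InPrefix l m') X ≡ m
count-InPrefix n l m m' X mm' m'l Xn rng D lo hi =
  trans (count-ext _ _ X ext) (trans (sym (count-const (InPrefix l m) X n Xn flat))
    (card-prefix n l m (≤-trans mm' m'l) (λ j a b → rng j a (≤-trans b mm'))
       (λ j j' a b c d e → D j j' a (≤-trans b mm') c (≤-trans d mm') e)))
  where
  ext : ∀ y → 1 ≤ y → y ≤ X → InPrefix l m' y ≡ InPrefix l m y
  ext y _ yX = bool-ext _ _ f (InPrefix-mono l m m' mm' y)
    where
    f : InPrefix l m' y ≡ true → InPrefix l m y ≡ true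
    f e with memb-take-witness y m' l e
    ... | j , a , b , c , d with j ≤? m
    ...   | yes jm = subst (λ z → InPrefix l m z ≡ true) d (memb-take-at j m l a jm c)
    ...   | no jm = ⊥-elim (<-irrefl refl (≤-<-trans yX (subst (X <_) d (hi j (≰⇒> jm) b))))
  flat : ∀ y → X < y → y ≤ n → InPrefix l m y ≡ false
  flat y Xy _ with InPrefix l m y in e
  ... | false = refl
  ... | true with memb-take-witness y m l e
  ...   | j , a , b , c , d = ⊥-elim (<-irrefl refl (<-≤-trans Xy (subst (_≤ X) d (lo j a b))))

module _ (n : ℕ) (R : List ℕ) (γ : Vec ℕ n) where

  ΠL : ℕ → List ℕ
  ΠL = ΠList n R γ

  ΠList-len : ∀ i → length (ΠL i) ≡ i
  ΠList-len zero = refl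
  ΠList-len (suc i) = trans (LP.length-++ (ΠL i)) (trans (+-comm (length (ΠL i)) 1) (cong suc (ΠList-len i)))

  ΠList-take : ∀ i m → i ≤ m → take i (ΠL m) ≡ ΠL i
  ΠList-take i m le with m≤n⇒m<n∨m≡n le
  ... | inj₂ refl = LP.take-all i (ΠL i) (≤-reflexive (ΠList-len i))
  ΠList-take i (suc m) le | inj₁ (s≤s lt) =
    trans (take-++ˡ i (ΠL m) _ (subst (i ≤_) (sym (ΠList-len m)) lt)) (ΠList-take i m lt)

  ΠList-get : ∀ j m → 1 ≤ j → j ≤ m → get 0 (ΠL m) j ≡ ΠVal n R γ (ΠL (pred j)) j
  ΠList-get (suc j) m a le with m≤n⇒m<n∨m≡n le
  ... | inj₂ refl = subst (λ k → get 0 (ΠL (suc j)) (suc k) ≡ ΠVal n R γ (ΠL j) (suc j)) (ΠList-len j) (get-snoc 0 (ΠL j) (ΠVal n R γ (ΠL j) (suc j)))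
  ΠList-get (suc j) (suc m) a le | inj₁ (s≤s lt) =
    trans (get-++ˡ 0 (ΠL m) _ (suc j) (subst (suc j ≤_) (sym (ΠList-len m)) lt)) (ΠList-get (suc j) m a lt)

  Π-get : ∀ i → 1 ≤ i → i ≤ n → Π n R γ ! i ≡ get 0 (ΠL n) i
  Π-get i a b = get-tab 0 n (λ k → get 0 (ΠL n) k) i a b

  toList-Π : toList (Π n R γ) ≡ ΠL n
  toList-Π = list-ext 0 _ _ (trans (len-toList (Π n R γ)) (sym (ΠList-len n)))
    (λ j a b → Π-get j a (subst (j ≤_) (len-toList (Π n R γ)) b))

ΠVal-zero : ∀ n R γ acc i → below R i ≡ 0 → ΠVal n R γ acc i ≡ γ ! i
ΠVal-zero n R γ acc i e rewrite e = refl

ΠVal-suc : ∀ n R γ acc i k → below R i ≡ suc k →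
  ΠVal n R γ acc i ≡
    (let Q = q n R (suc k)
         g = γ ! Q
         s = if γ ! suc Q ≤ᵇ g then suc (g ∸ γ ! suc Q) else 0
     in if i ≤ᵇ Q + s then rankL (suc (Q + s) ∸ i) (filter (λ x → memb x (take Q acc) B.≟ false) (desc g)) else γ ! i)
ΠVal-suc n R γ acc i k e rewrite e = refl

record Chain (n : ℕ) (R : List ℕ) (B : ℕ → ℕ → Bool) : Set where
  constructor mkChain
  field
    empty : ∀ x → B 0 x ≡ false
    mono  : ∀ h → h ≤ length R → ∀ x → B h x ≡ true → B (suc h) x ≡ true
    range : ∀ h x → B h x ≡ true → 1 ≤ x × x ≤ n
    card  : ∀ h → h ≤ suc (length R) → count (B h) n ≡ q n R h

-- The chain form of 312-avoidance: no w < z < x with w ∈ B_{h+1} ∖ B_h, z ∉ B_{h+1}, x ∈ B_h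
-- (h ∈ [r-1]; for h = r there is no z ∉ B_{r+1} anyway).
Chain312Free : ℕ → List ℕ → (ℕ → ℕ → Bool) → Set
Chain312Free n R B = ∀ h → 1 ≤ h → h ≤ length R → ∀ w z x → B (suc h) w ≡ true → B h w ≡ false →
  B (suc h) z ≡ false → B h x ≡ true → w < z → z < x → ⊥

-- γ is the rank tuple of B: for i in the carrel of level h, γ_i ∈ B_h and exactly i elements of B_h
-- are ≤ γ_i, i.e. γ_i is the i-th smallest element of B_h.
IsRankTuple : (n : ℕ) → List ℕ → (ℕ → ℕ → Bool) → Vec ℕ n → Set
IsRankTuple n R Bf γ = ∀ i → 1 ≤ i → i ≤ n → Bf (suc (below R i)) (γ ! i) ≡ true × count (Bf (suc (below R i))) (γ ! i) ≡ i

rankTuple : (n : ℕ) → List ℕ → (ℕ → Subset n) → Vec ℕ n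
rankTuple n R Sf = V.tabulate λ j →
  let i = suc (toℕ j)
      h = suc (below R i)
  in rankL (suc (q n R h) ∸ i) (elemsDesc (Sf h))

-- It is a rank tuple whenever |S_h| = q_h: rank^{q_h − i + 1} is the i-th smallest element.
rankTuple-isRankTuple : ∀ n R → 1 ≤ n → ValidR n R → (Sf : ℕ → Subset n) →
  (∀ h → 1 ≤ h → h ≤ suc (length R) → count (λ x → x ∈S Sf h) n ≡ q n R h) →
  IsRankTuple n R (λ h x → x ∈S Sf h) (rankTuple n R Sf)
rankTuple-isRankTuple n R n1 V Sf card i i1 in' with carrel-of n R n1 V i i1 in'
... | lo , hi , br = subst (λ v → f v ≡ true × count f v ≡ i) (sym geq) (a , c3)
  where
  h Qh d : ℕ
  h = suc (below R i)
  Qh = q n R h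
  d = Qh ∸ i
  f : ℕ → Bool
  f x = x ∈S Sf h
  geq : rankTuple n R Sf ! i ≡ rank f n d
  geq = trans (get-tab 0 n (λ i → rankL (suc (q n R (suc (below R i))) ∸ i) (elemsDesc (Sf (suc (below R i))))) i i1 in')
     (cong (λ k → get 0 (filterᵇ f (desc n)) k) (+-∸-assoc 1 hi))
  cardh : count f n ≡ Qh
  cardh = card h (s≤s z≤n) (s≤s br)
  le : suc d ≤ count f n
  le = subst (suc d ≤_) (sym cardh) (subst (_≤ Qh) (+-∸-assoc 1 hi) (∸-monoʳ-≤ (suc Qh) i1))
  spec : f (rank f n d) ≡ true × 1 ≤ rank f n d × rank f n d ≤ n × count f n ≡ d + count f (rank f n d)
  spec = rank-spec f n d le
  a : f (rank f n d) ≡ true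
  a = proj₁ spec
  c3 : count f (rank f n d) ≡ i
  c3 = +-cancelˡ-≡ d _ _ (trans (sym (proj₂ (proj₂ (proj₂ spec)))) (trans cardh (sym (m∸n+n≡m hi))))

module RankTuples (n : ℕ) (R : List ℕ) (n1 : 1 ≤ n) (V : ValidR n R) (B : ℕ → ℕ → Bool)
                  (γ : Vec ℕ n) (sel : IsRankTuple n R B γ) where

  r : ℕ
  r = length R

  γlast γnext : ℕ → ℕ
  γlast h = γ ! q n R h
  γnext h = γ ! suc (q n R h)

  rankTuple-at : ∀ k i → k ≤ r → q n R k < i → i ≤ q n R (suc k) →
    B (suc k) (γ ! i) ≡ true × count (B (suc k)) (γ ! i) ≡ i
  rankTuple-at k i kr a b = subst (λ k' → B (suc k') (γ ! i) ≡ true × count (B (suc k')) (γ ! i) ≡ i)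
    (below-unique n R n1 V i k kr a b) (sel i (≤-trans (s≤s z≤n) a) (≤-trans b (q-≤n n R n1 V (suc k) (s≤s kr))))

  rankTuple-last : ∀ h → 1 ≤ h → h ≤ suc r → B h (γlast h) ≡ true × count (B h) (γlast h) ≡ q n R h
  rankTuple-last (suc k) _ (s≤s kr) = rankTuple-at k (q n R (suc k)) kr (q-mono n R n1 V k (suc k) ≤-refl (s≤s kr)) ≤-refl

  rankTuple-first : ∀ h → h ≤ r → B (suc h) (γnext h) ≡ true × count (B (suc h)) (γnext h) ≡ suc (q n R h)
  rankTuple-first h hr = rankTuple-at h (suc (q n R h)) hr ≤-refl (q-mono n R n1 V h (suc h) ≤-refl (s≤s hr))

  -- The rank tuple of a chain lies in UI_R(n): its entries are in [n], γ_i ≥ i because γ_i is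
  -- the i-th smallest element of a set, and ranks increase along a carrel.
  rankTuple-inUI : Chain n R B → InUI n R γ
  rankTuple-inUI ch = inRange , above , carrelInc
    where
    inRange : IsRTuple n γ
    inRange i a b = Chain.range ch _ _ (proj₁ (sel i a b))
    above : ∀ i → 1 ≤ i → i ≤ n → i ≤ γ ! i
    above i a b = subst (_≤ γ ! i) (proj₂ (sel i a b)) (count-≤ _ _)
    carrelInc : CarrelInc n R γ
    carrelInc (suc k) _ (s≤s kr) i j a ij jb =
      count-reflect-< (B (suc k)) _ _ (subst₂ _<_ (sym (proj₂ (rankTuple-at k i kr a (≤-trans (<⇒≤ ij) jb))))
                                                  (sym (proj₂ (rankTuple-at k j kr (<-trans a ij) jb))) ij)

  module _ (ch : Chain n R B) where

    -- If γ_{q_h+1} ≤ γ_{q_h} (a descent at q_h), then B_{h+1} has more elements up to γ_{q_h+1}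
    -- than B_h, hence contains a new element w ≤ γ_{q_h+1}.
    new-below-first : ∀ h → 1 ≤ h → h ≤ r → γnext h ≤ γlast h →
      Σ ℕ λ w → 1 ≤ w × w ≤ γnext h × B (suc h) w ≡ true × B h w ≡ false
    new-below-first h h1 hr yM = count-witness (B h) (B (suc h)) (γnext h) (λ z _ _ → Chain.mono ch h hr z) fewer
      where
      fewer : count (B h) (γnext h) < count (B (suc h)) (γnext h)
      fewer = subst (count (B h) (γnext h) <_) (sym (proj₂ (rankTuple-first h hr)))
        (s≤s (subst (count (B h) (γnext h) ≤_) (proj₂ (rankTuple-last h h1 (m≤n⇒m≤1+n hr))) (count-mono (B h) yM)))

    module _ (free : Chain312Free n R B) where

      -- At a descent, the whole interval [γ_{q_h+1}, γ_{q_h}] lies in B_{h+1}: a missing z would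
      -- form the forbidden pattern  w < z < γ_{q_h}  with w new in B_{h+1} and γ_{q_h} ∈ B_h.
      interval-in-next : ∀ h → 1 ≤ h → h ≤ r → γnext h ≤ γlast h →
        ∀ z → γnext h ≤ z → z ≤ γlast h → B (suc h) z ≡ true
      interval-in-next h h1 hr yM z yz zM with B (suc h) z in missing | new-below-first h h1 hr yM
      ... | true | _ = refl
      ... | false | w , _ , wy , new , old =
        ⊥-elim (free h h1 hr w z (γlast h) new old missing (proj₁ last) (≤-<-trans wy y<z) z<M)
        where
        last : B h (γlast h) ≡ true × count (B h) (γlast h) ≡ q n R h
        last = rankTuple-last h h1 (m≤n⇒m≤1+n hr)
        y<z : γnext h < z
        y<z with m≤n⇒m<n∨m≡n yz
        ... | inj₁ lt = lt
        ... | inj₂ refl with trans (sym (proj₁ (rankTuple-first h hr))) missing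
        ...   | ()
        z<M : z < γlast h
        z<M with m≤n⇒m<n∨m≡n zM
        ... | inj₁ lt = lt
        ... | inj₂ refl with trans (sym (Chain.mono ch h hr (γlast h) (proj₁ last))) missing
        ...   | ()

      count-interval : ∀ h → 1 ≤ h → h ≤ r → (yM : γnext h ≤ γlast h) → ∀ t → t ≤ γlast h ∸ γnext h →
        count (B (suc h)) (γnext h + t) ≡ t + suc (q n R h)
      count-interval h h1 hr yM t td =
        trans (count-run (B (suc h)) (γnext h) t (λ z a b → interval-in-next h h1 hr yM z a (≤-trans b y+t≤M)))
              (cong (t +_) (proj₂ (rankTuple-first h hr)))
        where
        y+t≤M : γnext h + t ≤ γlast h
        y+t≤M = subst (γnext h + t ≤_) (m+[n∸m]≡n yM) (+-monoʳ-≤ (γnext h) td)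

      count-next-at-last : ∀ h → 1 ≤ h → h ≤ r → (yM : γnext h ≤ γlast h) →
        count (B (suc h)) (γlast h) ≡ q n R h + suc (γlast h ∸ γnext h)
      count-next-at-last h h1 hr yM = begin
        count (B (suc h)) (γlast h)      ≡⟨ cong (count (B (suc h))) (sym (m+[n∸m]≡n yM)) ⟩
        count (B (suc h)) (γnext h + d)  ≡⟨ count-interval h h1 hr yM d ≤-refl ⟩
        d + suc (q n R h)                ≡⟨ +-comm d (suc (q n R h)) ⟩
        suc (q n R h) + d                ≡⟨ sym (+-suc (q n R h) d) ⟩
        q n R h + suc d                  ∎
        where
        open ≡-Reasoning
        d : ℕ
        d = γlast h ∸ γnext h

      gap-fits : ∀ h → 1 ≤ h → h ≤ r → (yM : γnext h ≤ γlast h) →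
        q n R h + suc (γlast h ∸ γnext h) ≤ q n R (suc h)
      gap-fits h h1 hr yM = begin
        q n R h + suc (γlast h ∸ γnext h)  ≡⟨ sym (count-next-at-last h h1 hr yM) ⟩
        count (B (suc h)) (γlast h)        ≤⟨ count-mono (B (suc h)) M≤n ⟩
        count (B (suc h)) n                ≡⟨ Chain.card ch (suc h) (s≤s hr) ⟩
        q n R (suc h)                      ∎
        where
        open ≤-Reasoning
        M≤n : γlast h ≤ n
        M≤n = proj₂ (Chain.range ch h _ (proj₁ (rankTuple-last h h1 (m≤n⇒m≤1+n hr))))

      gap-values : ∀ h → 1 ≤ h → h ≤ r → (yM : γnext h ≤ γlast h) → ∀ t → 1 ≤ t → t ≤ suc (γlast h ∸ γnext h) →
        γ ! (q n R h + t) ≡ (γlast h + t) ∸ suc (γlast h ∸ γnext h)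
      gap-values h h1 hr yM (suc t) _ (s≤s td) = trans same-rank arith
        where
        Q d : ℕ
        Q = q n R h
        d = γlast h ∸ γnext h
        at : B (suc h) (γ ! (Q + suc t)) ≡ true × count (B (suc h)) (γ ! (Q + suc t)) ≡ Q + suc t
        at = rankTuple-at h (Q + suc t) hr (m<m+n Q (s≤s z≤n)) (≤-trans (+-monoʳ-≤ Q (s≤s td)) (gap-fits h h1 hr yM))
        y+t≤M : γnext h + t ≤ γlast h
        y+t≤M = subst (γnext h + t ≤_) (m+[n∸m]≡n yM) (+-monoʳ-≤ (γnext h) td)
        same-rank : γ ! (Q + suc t) ≡ γnext h + t
        same-rank = count-injective (B (suc h)) (proj₁ at) (interval-in-next h h1 hr yM _ (m≤m+n _ t) y+t≤M)
          (trans (proj₂ at) (sym (trans (count-interval h h1 hr yM t td) (trans (+-comm t (suc Q)) (sym (+-suc Q t))))))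
        arith : γnext h + t ≡ (γlast h + suc t) ∸ suc d
        arith = trans (sym (m+n∸m≡n (suc d) (γnext h + t)))
                      (cong (_∸ suc d) (trans (+-shuffle (γnext h) d t) (cong (_+ suc t) (m+[n∸m]≡n yM))))
          where
          +-shuffle : ∀ y d t → suc d + (y + t) ≡ y + d + suc t
          +-shuffle = solve-∀

      -- B_{h+1} ∖ B_h has exactly s elements up to γ_{q_h}, as B_h has q_h of them.
      count-new-at-last : ∀ h → 1 ≤ h → h ≤ r → (yM : γnext h ≤ γlast h) →
        count (λ z → B (suc h) z ∧ not (B h z)) (γlast h) ≡ suc (γlast h ∸ γnext h)
      count-new-at-last h h1 hr yM = +-cancelˡ-≡ (q n R h) _ _
        (trans (sym (trans (count-split (B h) (B (suc h)) (γlast h) (λ z _ _ → Chain.mono ch h hr z))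
                           (cong (_+ count (λ z → B (suc h) z ∧ not (B h z)) (γlast h)) (proj₂ (rankTuple-last h h1 (m≤n⇒m≤1+n hr))))))
               (count-next-at-last h h1 hr yM))

      -- The s largest elements of [γ_{q_h}] ∖ B_h all lie in B_{h+1}: by 312-freeness none of the s
      -- new elements up to γ_{q_h} lies below an element x ∉ B_{h+1}, so such an x has at least s
      -- elements of [γ_{q_h}] ∖ B_h above it.
      top-free-in-next : ∀ h → 1 ≤ h → h ≤ r → (yM : γnext h ≤ γlast h) → ∀ x d →
        B h x ≡ false → x ≤ γlast h →
        count (λ z → not (B h z)) (γlast h) ≡ d + count (λ z → not (B h z)) x →
        d < suc (γlast h ∸ γnext h) → B (suc h) x ≡ true
      top-free-in-next h h1 hr yM x d old xM above d<s with B (suc h) x in missing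
      ... | true = refl
      ... | false = ⊥-elim (<-irrefl refl (<-≤-trans d<s s≤d))
        where
        s : ℕ
        s = suc (γlast h ∸ γnext h)
        outside new : ℕ → Bool
        outside z = not (B h z)
        new z = B (suc h) z ∧ not (B h z)
        last : B h (γlast h) ≡ true × count (B h) (γlast h) ≡ q n R h
        last = rankTuple-last h h1 (m≤n⇒m≤1+n hr)
        x<M : x < γlast h
        x<M with m≤n⇒m<n∨m≡n xM
        ... | inj₁ lt = lt
        ... | inj₂ refl with trans (sym old) (proj₁ last)
        ...   | ()
        none-below : ∀ w → 1 ≤ w → w ≤ x → new w ≡ false
        none-below w _ wx with new w in isNew
        ... | false = refl
        ... | true = ⊥-elim (free h h1 hr w x (γlast h) (proj₁ (∧-true _ _ isNew)) (not-true _ (proj₂ (∧-true _ _ isNew)))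
                               missing (proj₁ last) w<x x<M)
          where
          w<x : w < x
          w<x with m≤n⇒m<n∨m≡n wx
          ... | inj₁ lt = lt
          ... | inj₂ refl with trans (sym (proj₁ (∧-true _ _ isNew))) missing
          ...   | ()
        s≤d : s ≤ d
        s≤d = +-cancelʳ-≤ (count outside x) s d (begin
          s + count outside x                          ≡⟨ cong (_+ count outside x) (sym (count-new-at-last h h1 hr yM)) ⟩
          count new (γlast h) + count outside x        ≤⟨ count-incl-interval new outside (γlast h) x (λ z _ _ e → proj₂ (∧-true _ _ e)) xM ⟩
          count outside (γlast h) + count new x        ≡⟨ cong₂ _+_ above (count-none new x none-below) ⟩
          d + count outside x + 0                      ≡⟨ +-identityʳ _ ⟩
          d + count outside x                          ∎)
          where open ≤-Reasoning

      rankTuple-gapless : InUG n R γ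
      rankTuple-gapless = rankTuple-inUI ch , λ h h1 hr yM →
        m+n≤o⇒m≤o∸n (suc (γlast h ∸ γnext h)) (subst (_≤ q n R (suc h)) (+-comm (q n R h) _) (gap-fits h h1 hr yM)) ,
        gap-values h h1 hr yM

prefixChain : (n : ℕ) → List ℕ → Vec ℕ n → ℕ → ℕ → Bool
prefixChain n R π h x = InPrefix (toList π) (q n R h) x

-- Carrel h+1 consists
-- of a shifted block (q_h, q_h + s_h], filled with the s_h largest values ≤ γ_{q_h} not used
-- before, followed by kept positions where π_i = γ_i.  The invariant 'Prefix h' (values of the
-- first q_h positions in [n], distinct, ≤ γ_{q_h}, with γ_{q_h} among them) is established carrel
-- by carrel in the submodule Step, which also shows that the new carrel is increasing, that the
-- prefix chain gains no 312 pattern, and that γ is its rank tuple.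
module PiOfGapless (n : ℕ) (R : List ℕ) (n1 : 1 ≤ n) (V : ValidR n R) (γ : Vec ℕ n) (ug : InUG n R γ) where
  r : ℕ
  r = length R

  γ-inRange : IsRTuple n γ
  γ-inRange = proj₁ (proj₁ ug)

  γ-above : ∀ i → 1 ≤ i → i ≤ n → i ≤ γ ! i
  γ-above = proj₁ (proj₂ (proj₁ ug))

  γ-inc : CarrelInc n R γ
  γ-inc = proj₂ (proj₂ (proj₁ ug))

  l : List ℕ
  l = ΠList n R γ n

  v : ℕ → ℕ
  v j = get 0 l j

  P : ℕ → ℕ → Bool
  P k = InPrefix l k

  lenl : length l ≡ n
  lenl = ΠList-len n R γ n

  -- top h = γ_{q_h}; shift h = s_h is the size of the shifted block of carrel h+1; avail h are
  -- the values not used by the first q_h positions.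
  top : ℕ → ℕ
  top h = γ ! q n R h

  shift : ℕ → ℕ
  shift h = if γ ! suc (q n R h) ≤ᵇ γ ! q n R h then suc (γ ! q n R h ∸ γ ! suc (q n R h)) else 0

  avail : ℕ → ℕ → Bool
  avail h x = not (P (q n R h) x)

  γ-carrelInc : ∀ h i j → h ≤ r → q n R h < i → i < j → j ≤ q n R (suc h) → γ ! i < γ ! j
  γ-carrelInc h i j hr a ij jb = γ-inc (suc h) (s≤s z≤n) (s≤s hr) i j a ij jb

  qn : ∀ h → h ≤ suc r → q n R h ≤ n
  qn h hr = q-≤n n R n1 V h hr

  q<q' : ∀ h → h ≤ r → q n R h < q n R (suc h)
  q<q' h hr = q-mono n R n1 V h (suc h) ≤-refl (s≤s hr)

  take-Π : ∀ k → k ≤ n → take k l ≡ ΠList n R γ k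
  take-Π k kn = ΠList-take n R γ k n kn

  shift₀ : shift 0 ≡ 0
  shift₀ rewrite ≤ᵇ-false (γ ! 1) (γ ! 0) (subst (λ k → suc k ≤ γ ! 1) (sym (get-0 0 (toList γ))) (proj₁ (γ-inRange 1 ≤-refl n1))) = refl

  Π-entry : ∀ i → 1 ≤ i → i ≤ n → v i ≡ ΠVal n R γ (ΠList n R γ (pred i)) i
  Π-entry i a b = ΠList-get n R γ i n a b

  Π-beyondShift : ∀ h i → h ≤ r → q n R h + shift h < i → i ≤ q n R (suc h) → v i ≡ γ ! i
  Π-beyondShift zero i hr a b = trans (Π-entry i (≤-trans (s≤s z≤n) a) (≤-trans b (qn 1 (s≤s z≤n))))
    (ΠVal-zero n R γ _ i (below-unique n R n1 V i 0 z≤n (≤-trans (s≤s z≤n) a) b))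
  Π-beyondShift (suc k) i hr a b
    rewrite Π-entry i (≤-trans (s≤s z≤n) a) (≤-trans b (qn (suc (suc k)) (s≤s hr)))
          | ΠVal-suc n R γ (ΠList n R γ (pred i)) i k (below-unique n R n1 V i (suc k) hr (≤-<-trans (m≤m+n _ _) a) b)
          | ≤ᵇ-false i (q n R (suc k) + shift (suc k)) a = refl

  Π-withinShift : ∀ h i → h ≤ r → q n R h < i → i ≤ q n R h + shift h → i ≤ q n R (suc h) → v i ≡ rank (avail h) (top h) (q n R h + shift h ∸ i)
  Π-withinShift zero i hr a b c rewrite shift₀ | +-identityʳ (q n R 0) = ⊥-elim (<-irrefl refl (<-≤-trans a b))
  Π-withinShift (suc k) i hr a b c
    rewrite Π-entry i (≤-trans (s≤s z≤n) a) (≤-trans c (qn (suc (suc k)) (s≤s hr)))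
          | ΠVal-suc n R γ (ΠList n R γ (pred i)) i k (below-unique n R n1 V i (suc k) hr a c)
          | ≤ᵇ-true i (q n R (suc k) + shift (suc k)) b
          | trans (ΠList-take n R γ (q n R (suc k)) (pred i) (<⇒≤pred a)) (sym (take-Π (q n R (suc k)) (≤-trans (<⇒≤ a) (≤-trans c (qn (suc (suc k)) (s≤s hr))))))
          | filter-false (λ x → memb x (take (q n R (suc k)) l)) (desc (γ ! q n R (suc k)))
          | +-∸-assoc 1 b = refl

  shift-yes : ∀ h → (γ ! suc (q n R h) ≤ᵇ γ ! q n R h) ≡ true → shift h ≡ suc (γ ! q n R h ∸ γ ! suc (q n R h))
  shift-yes h e rewrite e = refl

  q+1≤n : ∀ h → h ≤ r → suc (q n R h) ≤ n
  q+1≤n h hr = ≤-trans (q<q' h hr) (qn (suc h) (s≤s hr))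

  shift-facts : ∀ h → h ≤ r → 1 ≤ shift h →
    1 ≤ h × γ ! suc (q n R h) ≤ top h × shift h ≤ q n R (suc h) ∸ q n R h ×
    (∀ t → 1 ≤ t → t ≤ shift h → γ ! (q n R h + t) ≡ (top h + t) ∸ shift h)
  shift-facts h hr s1 with γ ! suc (q n R h) ≤ᵇ γ ! q n R h in e
  ... | false with s1
  ...   | ()
  shift-facts zero hr s1 | true = ⊥-elim (1≰0 (≤-trans (proj₁ (γ-inRange 1 ≤-refl n1)) (subst (γ ! 1 ≤_) (get-0 0 (toList γ)) (≤ᵇ⇒≤ _ _ (subst T (sym e) tt)))))
    where
    1≰0 : ¬ 1 ≤ 0
    1≰0 ()
  shift-facts (suc k) hr s1 | true with proj₂ ug (suc k) (s≤s z≤n) hr (≤ᵇ⇒≤ _ _ (subst T (sym e) tt))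
  ... | a , b = s≤s z≤n , ≤ᵇ⇒≤ _ _ (subst T (sym e) tt) , a , b

  q+shift≤top : ∀ h → h ≤ r → 1 ≤ shift h → q n R h + shift h ≤ top h
  q+shift≤top h hr s1 with shift-facts h hr s1
  ... | _ , _ , _ , vals = subst (_≤ top h) (+-comm (shift h) Q) (≤-pred (subst₂ _≤_ (+-suc (shift h) Q) (+-comm (top h) 1) s+Q<top+1))
    where
    Q : ℕ
    Q = q n R h
    -- γ_{Q+1} ≥ Q + 1, and γ_{Q+1} = top + 1 − s by gaplessness.
    ge1 : suc Q ≤ γ ! (Q + 1)
    ge1 = subst (λ k → k ≤ γ ! (Q + 1)) (+-comm Q 1) (γ-above (Q + 1) (subst (1 ≤_) (+-comm 1 Q) (s≤s z≤n)) (subst (_≤ n) (+-comm 1 Q) (q+1≤n h hr)))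
    first≤ : suc Q ≤ (top h + 1) ∸ shift h
    first≤ = subst (suc Q ≤_) (vals 1 ≤-refl s1) ge1
    s+Q<top+1 : shift h + suc Q ≤ top h + 1
    s+Q<top+1 = ∸-split (top h + 1) (shift h) Q first≤

  q+shift≤q' : ∀ h → h ≤ r → q n R h + shift h ≤ q n R (suc h)
  q+shift≤q' h hr with shift h in e
  ... | zero = subst (_≤ q n R (suc h)) (sym (+-identityʳ _)) (<⇒≤ (q<q' h hr))
  ... | suc s' with shift-facts h hr (subst (1 ≤_) (sym e) (s≤s z≤n))
  ...   | _ , _ , le , _ = subst (_≤ q n R (suc h)) (+-comm (suc s') (q n R h))
            (subst (suc s' + q n R h ≤_) (m∸n+n≡m {q n R (suc h)} {q n R h} (<⇒≤ (q<q' h hr)))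
              (+-monoˡ-≤ (q n R h) (subst (_≤ q n R (suc h) ∸ q n R h) e le)))

  top<beyondShift : ∀ h i → h ≤ r → q n R h + shift h < i → i ≤ q n R (suc h) → top h < γ ! i
  top<beyondShift h i hr a b with γ ! suc (q n R h) ≤ᵇ γ ! q n R h in e
  ... | false with m≤n⇒m<n∨m≡n (subst (_< i) (+-identityʳ (q n R h)) a)
  ...   | inj₂ refl = ≤ᵇ-false⇒> _ _ e
  ...   | inj₁ lt = <-trans (≤ᵇ-false⇒> _ _ e) (γ-carrelInc h (suc (q n R h)) i hr ≤-refl lt b)
  top<beyondShift h i hr a b | true with shift-facts h hr (subst (1 ≤_) (sym (shift-yes h e)) (s≤s z≤n))
  ...   | _ , _ , _ , vals = subst (_< γ ! i) (trans (vals (shift h) s1 ≤-refl) (m+n∸n≡m (top h) (shift h)))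
            (γ-carrelInc h (q n R h + shift h) i hr (subst (_≤ q n R h + shift h) (+-comm (q n R h) 1) (+-monoʳ-≤ (q n R h) s1)) (subst (λ k → q n R h + k < i) (sym (shift-yes h e)) a) b)
    where
    s1 : 1 ≤ shift h
    s1 = subst (1 ≤_) (sym (shift-yes h e)) (s≤s z≤n)

  Prefix : ℕ → Set
  Prefix h = InRange n l (q n R h) × Distinct l (q n R h) × (∀ j → 1 ≤ j → j ≤ q n R h → v j ≤ top h) × (1 ≤ h → P (q n R h) (top h) ≡ true)

  prefix₀ : Prefix 0
  prefix₀ = (λ { (suc j) a () }) , (λ { (suc j) j' a () }) , (λ { (suc j) a () }) , λ ()

  top≤n : ∀ h → h ≤ suc r → top h ≤ n
  top≤n h hr with q n R h in e
  ... | zero = subst (_≤ n) (sym (get-0 0 (toList γ))) z≤n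
  ... | suc Q = proj₂ (γ-inRange (suc Q) (s≤s z≤n) (subst (_≤ n) e (qn h hr)))

  q≤length : ∀ h → h ≤ suc r → q n R h ≤ length l
  q≤length h hr = subst (q n R h ≤_) (sym lenl) (qn h hr)

  module Step (h : ℕ) (hr : h ≤ r) (I : Prefix h) where
    Q Q' M s : ℕ
    Q = q n R h
    Q' = q n R (suc h)
    M = top h
    s = shift h

    A : ℕ → Bool
    A = avail h

    QQ' : Q < Q'
    QQ' = q<q' h hr
    Q'n : Q' ≤ n
    Q'n = qn (suc h) (s≤s hr)
    sQ : Q + s ≤ Q'
    sQ = q+shift≤q' h hr
    rngQ : InRange n l Q
    rngQ = proj₁ I

    DQ : Distinct l Q
    DQ = proj₁ (proj₂ I)

    maxQ : ∀ j → 1 ≤ j → j ≤ Q → v j ≤ M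
    maxQ = proj₁ (proj₂ (proj₂ I))

    memM : 1 ≤ h → P Q M ≡ true
    memM = proj₂ (proj₂ (proj₂ I))

    Mn' : M ≤ n
    Mn' = top≤n h (m≤n⇒m≤1+n hr)
    -- All Q old values are ≤ M, so M ∸ Q values ≤ M are still available.
    cPM : count (P Q) M ≡ Q
    cPM = count-InPrefix n l Q Q M ≤-refl (q≤length h (m≤n⇒m≤1+n hr)) Mn' rngQ DQ maxQ (λ j a b → ⊥-elim (<-irrefl refl (<-≤-trans a b)))
    cAM : count A M ≡ M ∸ Q
    cAM = trans (sym (m+n∸n≡m (count A M) Q)) (cong (_∸ Q) (trans (cong (count A M +_) (sym cPM)) (count-not (P Q) M)))

    module Shifted (i : ℕ) (a : Q < i) (b : i ≤ Q + s) where
      d : ℕ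
      d = (Q + s) ∸ i
      s1 : 1 ≤ s
      s1 = ≤-trans (s≤s z≤n) (rankIndex<shift Q s i a b)
      le : suc d ≤ count A M
      le = subst (suc d ≤_) (sym cAM) (≤-trans (rankIndex<shift Q s i a b) (m+n≤o⇒m≤o∸n s (subst (_≤ M) (+-comm Q s) (q+shift≤top h hr s1))))
      veq : v i ≡ rank A M d
      veq = Π-withinShift h i hr a b (≤-trans b sQ)
      spec : A (rank A M d) ≡ true × 1 ≤ rank A M d × rank A M d ≤ M × count A M ≡ d + count A (rank A M d)
      spec = rank-spec A M d le

      vA : A (v i) ≡ true
      vA = subst (λ x → A x ≡ true) (sym veq) (proj₁ spec)
      v1 : 1 ≤ v i
      v1 = subst (1 ≤_) (sym veq) (proj₁ (proj₂ spec))
      vM : v i ≤ M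
      vM = subst (_≤ M) (sym veq) (proj₁ (proj₂ (proj₂ spec)))
      vc : count A M ≡ d + count A (v i)
      vc = subst (λ x → count A M ≡ d + count A x) (sym veq) (proj₂ (proj₂ (proj₂ spec)))

    module Kept (i : ℕ) (a : Q + s < i) (b : i ≤ Q') where
      veq : v i ≡ γ ! i
      veq = Π-beyondShift h i hr a b
      Mlt : M < v i
      Mlt = subst (M <_) (sym veq) (top<beyondShift h i hr a b)
      vn : v i ≤ n
      vn = subst (_≤ n) (sym veq) (proj₂ (γ-inRange i (≤-trans (s≤s z≤n) a) (≤-trans b Q'n)))

    new-inRange : ∀ i → Q < i → i ≤ Q' → 1 ≤ v i × v i ≤ n
    new-inRange i a b with i ≤? Q + s
    ... | yes c = Shifted.v1 i a c , ≤-trans (Shifted.vM i a c) Mn'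
    ... | no c = ≤-trans (s≤s z≤n) (Kept.Mlt i (≰⇒> c) b) , Kept.vn i (≰⇒> c) b

    old≤top : ∀ x → P Q x ≡ true → x ≤ M
    old≤top x e with memb-take-witness x Q l e
    ... | j , a , b , c , d = subst (_≤ M) d (maxQ j a b)

    new∉old : ∀ i → Q < i → i ≤ Q' → P Q (v i) ≡ false
    new∉old i a b with i ≤? Q + s
    ... | yes c = not-true _ (Shifted.vA i a c)
    ... | no c with P Q (v i) in e
    ...   | false = refl
    ...   | true = ⊥-elim (<-irrefl refl (<-≤-trans (Kept.Mlt i (≰⇒> c) b) (old≤top (v i) e)))

    new-increasing : ∀ i j → Q < i → i < j → j ≤ Q' → v i < v j
    new-increasing i j a ij jb with j ≤? Q + s
    ... | yes jc = count-reflect-< A _ _ (+-trade-< (Shifted.d i a ic) (Shifted.d j a' jc) _ _ (trans (sym (Shifted.vc i a ic)) (Shifted.vc j a' jc)) (∸-monoʳ-< ij jc))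
      where
      a' : Q < j
      a' = <-trans a ij
      ic : i ≤ Q + s
      ic = ≤-trans (<⇒≤ ij) jc
    ... | no jc with i ≤? Q + s
    ...   | yes ic = ≤-<-trans (Shifted.vM i a ic) (Kept.Mlt j (≰⇒> jc) jb)
    ...   | no ic = subst₂ _<_ (sym (Kept.veq i (≰⇒> ic) (≤-trans (<⇒≤ ij) jb))) (sym (Kept.veq j (≰⇒> jc) jb))
                  (γ-carrelInc h i j hr a ij jb)

    q'≤length : Q' ≤ length l
    q'≤length = q≤length (suc h) (s≤s hr)

    inRange' : InRange n l Q'
    inRange' j a b with j ≤? Q
    ... | yes c = rngQ j a c
    ... | no c = new-inRange j (≰⇒> c) b

    old∈prefix : ∀ j → 1 ≤ j → j ≤ Q → P Q (v j) ≡ true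
    old∈prefix j a b = memb-take-at j Q l a b (≤-trans b (q≤length h (m≤n⇒m≤1+n hr)))

    distinct' : Distinct l Q'
    distinct' j j' a b a' b' e with j ≤? Q | j' ≤? Q
    ... | yes c | yes c' = DQ j j' a c a' c' e
    ... | yes c | no c' with trans (sym (subst (λ x → P Q x ≡ true) e (old∈prefix j a c))) (new∉old j' (≰⇒> c') b')
    ...   | ()
    distinct' j j' a b a' b' e | no c | yes c' with trans (sym (subst (λ x → P Q x ≡ true) (sym e) (old∈prefix j' a' c'))) (new∉old j (≰⇒> c) b)
    ...   | ()
    distinct' j j' a b a' b' e | no c | no c' with <-cmp j j'
    ... | tri≈ _ x _ = x
    ... | tri< x _ _ = ⊥-elim (<-irrefl e (new-increasing j j' (≰⇒> c) x b'))
    ... | tri> _ _ x = ⊥-elim (<-irrefl (sym e) (new-increasing j' j (≰⇒> c') x b))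

    top≤top' : M ≤ γ ! Q'
    top≤top' with m≤n⇒m<n∨m≡n sQ
    ... | inj₁ lt = <⇒≤ (top<beyondShift h Q' hr lt ≤-refl)
    ... | inj₂ eq = ≤-reflexive (sym (trans (cong (γ !_) (sym eq)) (trans (proj₂ (proj₂ (proj₂ (shift-facts h hr s1))) s s1 ≤-refl) (m+n∸n≡m M s))))
      where
      s1 : 1 ≤ s
      s1 = pos-of-+ Q s Q' eq QQ'

    ≤top' : ∀ j → 1 ≤ j → j ≤ Q' → v j ≤ γ ! Q'
    ≤top' j a b with j ≤? Q
    ... | yes c = ≤-trans (maxQ j a c) top≤top'
    ... | no c with j ≤? Q + s
    ...   | yes c' = ≤-trans (Shifted.vM j (≰⇒> c) c') top≤top'
    ...   | no c' with m≤n⇒m<n∨m≡n b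
    ...     | inj₂ refl = ≤-reflexive (Kept.veq j (≰⇒> c') b)
    ...     | inj₁ lt = <⇒≤ (subst (_< γ ! Q') (sym (Kept.veq j (≰⇒> c') b)) (γ-carrelInc h j Q' hr (≰⇒> c) lt ≤-refl))

    -- For a nonempty shifted block, its values are exactly the interval [γ_{q_h+1}, γ_{q_h}]
    -- (by gaplessness), every integer of which is in the new prefix set; hence the rank of
    -- γ_i in the new prefix set is i.
    module ShiftedRanks (s1 : 1 ≤ s) where
      h1 : 1 ≤ h
      h1 = proj₁ (shift-facts h hr s1)
      sM : s ≤ M
      sM = ≤-trans (m≤n+m s Q) (q+shift≤top h hr s1)
      AM : A M ≡ false
      AM = cong not (memM h1)
      cPM' : count (P Q') M ≡ Q + s
      cPM' = count-InPrefix n l (Q + s) Q' M sQ q'≤length Mn' inRange' distinct' lo hi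
        where
        lo : ∀ j → 1 ≤ j → j ≤ Q + s → v j ≤ M
        lo j a b with j ≤? Q
        ... | yes c = maxQ j a c
        ... | no c = Shifted.vM j (≰⇒> c) b
        hi : ∀ j → Q + s < j → j ≤ Q' → M < v j
        hi j a b = Kept.Mlt j a b
      Q1 : suc Q ≤ Q + s
      Q1 = subst (_≤ Q + s) (+-comm Q 1) (+-monoʳ-≤ Q s1)
      module First = Shifted (suc Q) ≤-refl Q1

      vmin dmin : ℕ
      vmin = v (suc Q)
      dmin = First.d

      sdmin : suc dmin ≡ s
      sdmin = shift-firstIndex Q s s1
      vminB : vmin + s ≤ M
      vminB = subst (_≤ M) (trans (+-comm (suc dmin) vmin) (cong (vmin +_) sdmin))
                (rank-room A vmin M dmin First.vA AM First.v1 First.vM First.vc)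
      shifted-fill : ∀ z → vmin ≤ z → z ≤ M → P Q' z ≡ true
      shifted-fill z a b with P Q z in e
      ... | true = InPrefix-mono l Q Q' (<⇒≤ QQ') z e
      ... | false = subst (λ x → P Q' x ≡ true) (trans veq ru) (memb-take-at i Q' l (≤-trans (s≤s z≤n) Qi) iQ' (≤-trans iQ' q'≤length))
        where
        Az : A z ≡ true
        Az = not-false _ e
        z1 : 1 ≤ z
        z1 = ≤-trans First.v1 a
        czM : count A z ≤ count A M
        czM = count-mono A b
        D : ℕ
        D = count A M ∸ count A z
        Deq : count A M ≡ D + count A z
        Deq = sym (m∸n+n≡m czM)
        D≤ : D ≤ dmin
        D≤ = subst (D ≤_) (trans (cong (_∸ count A vmin) First.vc) (m+n∸n≡m dmin (count A vmin))) (∸-monoʳ-≤ (count A M) (count-mono A a))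
        Ds : D < s
        Ds = subst (D <_) sdmin (s≤s D≤)
        i : ℕ
        i = (Q + s) ∸ D
        Qi : Q < i
        Qi = <-shiftIndex Q s D Ds
        is : i ≤ Q + s
        is = m∸n≤m (Q + s) D
        iQ' : i ≤ Q'
        iQ' = ≤-trans is sQ
        veq : v i ≡ rank A M D
        veq = trans (Shifted.veq i Qi is) (cong (rank A M) (m∸[m∸n]≡n (≤-trans (<⇒≤ Ds) (m≤n+m s Q))))
        ru : rank A M D ≡ z
        ru = rank-unique A M D z Az z1 b Deq

      shifted-rank : ∀ i → Q < i → i ≤ Q + s → P Q' (γ ! i) ≡ true × count (P Q') (γ ! i) ≡ i
      shifted-rank i a b = subst (λ x → P Q' x ≡ true × count (P Q') x ≡ i) (sym γi) (memc , cntc)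
        where
        t e c : ℕ
        t = i ∸ Q
        e = M ∸ s
        c = e + t
        Qt : Q + t ≡ i
        Qt = m+[n∸m]≡n (<⇒≤ a)
        t1 : 1 ≤ t
        t1 = m+n≤o⇒m≤o∸n 1 a
        ts : t ≤ s
        ts = subst (_≤ s) refl (+-cancelˡ-≤ Q t s (subst (_≤ Q + s) (sym Qt) b))
        γi : γ ! i ≡ c
        γi = trans (cong (γ !_) (sym Qt)) (trans (proj₂ (proj₂ (proj₂ (shift-facts h hr s1))) t t1 ts) (+-∸-comm t sM))
        Me : e + s ≡ M
        Me = m∸n+n≡m sM
        cM : c + (s ∸ t) ≡ M
        cM = trans (+-assoc e t (s ∸ t)) (trans (cong (e +_) (m+[n∸m]≡n ts)) Me)
        vmc : vmin ≤ c
        vmc = ≤-trans (m+n≤o⇒m≤o∸n vmin vminB) (m≤m+n e t)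
        memc : P Q' c ≡ true
        memc = shifted-fill c vmc (subst (c ≤_) cM (m≤m+n c (s ∸ t)))
        run : count (P Q') M ≡ (s ∸ t) + count (P Q') c
        run = trans (cong (count (P Q')) (sym cM)) (count-run (P Q') c (s ∸ t) (λ z a' b' → shifted-fill z (≤-trans vmc a') (subst (z ≤_) cM b')))
        cntc : count (P Q') c ≡ i
        cntc = trans (+-cancelˡ-≡ (s ∸ t) _ _ (trans (sym run) (trans cPM'
                 (trans (cong (Q +_) (sym (m∸n+n≡m ts))) (+-swap Q (s ∸ t) t))))) Qt

    -- Kept values: γ_i exceeds all earlier values and is below the later ones of the carrel.
    kept-rank : ∀ i → Q + s < i → i ≤ Q' → P Q' (γ ! i) ≡ true × count (P Q') (γ ! i) ≡ i
    kept-rank i a b = subst (λ x → P Q' x ≡ true × count (P Q') x ≡ i) (Kept.veq i a b)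
      (memb-take-at i Q' l i1 b (≤-trans b q'≤length) ,
       count-InPrefix n l i Q' (v i) b q'≤length (Kept.vn i a b) inRange' distinct' lo hi)
      where
      i1 : 1 ≤ i
      i1 = ≤-trans (s≤s z≤n) a
      lo : ∀ j → 1 ≤ j → j ≤ i → v j ≤ v i
      lo j a' b' with j ≤? Q
      ... | yes c = ≤-trans (maxQ j a' c) (<⇒≤ (Kept.Mlt i a b))
      ... | no c with j ≤? Q + s
      ...   | yes c' = ≤-trans (Shifted.vM j (≰⇒> c) c') (<⇒≤ (Kept.Mlt i a b))
      ...   | no c' with m≤n⇒m<n∨m≡n b'
      ...     | inj₂ refl = ≤-refl
      ...     | inj₁ lt = <⇒≤ (new-increasing j i (≰⇒> c) lt b)
      hi : ∀ j → i < j → j ≤ Q' → v i < v j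
      hi j a' b' = new-increasing i j (≤-<-trans (m≤m+n Q s) a) a' b'

    rank-step : ∀ i → Q < i → i ≤ Q' → P Q' (γ ! i) ≡ true × count (P Q') (γ ! i) ≡ i
    rank-step i a b with i ≤? Q + s
    ... | yes c = ShiftedRanks.shifted-rank (≤-trans (s≤s z≤n) (rankIndex<shift Q s i a c)) i a c
    ... | no c = kept-rank i (≰⇒> c) b

    prefix-step : Prefix (suc h)
    prefix-step = inRange' , distinct' , ≤top' , λ _ → proj₁ (rank-step Q' QQ' ≤-refl)

    -- The new level adds no 312 pattern: a new value w is either kept (then w > M ≥ x) or
    -- shifted (then every z between w and x ≤ M is filled).
    free-step : 1 ≤ h → ∀ w z x → P Q' w ≡ true → P Q w ≡ false → P Q' z ≡ false → P Q x ≡ true → w < z → z < x → ⊥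
    free-step h1 w z x pw nw nz px wz zx with memb-take-witness w Q' l pw
    ... | j , a , b , c , d with j ≤? Q
    ...   | yes jq with trans (sym (subst (λ y → P Q y ≡ true) d (memb-take-at j Q l a jq (≤-trans jq (q≤length h (m≤n⇒m≤1+n hr)))))) nw
    ...     | ()
    free-step h1 w z x pw nw nz px wz zx | j , a , b , c , d | no jq with j ≤? Q + s
    ...   | no js = ⊥-elim (<-irrefl refl (<-trans (subst (M <_) d (Kept.Mlt j (≰⇒> js) b)) (<-≤-trans (<-trans wz zx) (old≤top x px))))
    ...   | yes js with trans (sym (ShiftedRanks.shifted-fill s1 z vz (<⇒≤ (<-≤-trans zx (old≤top x px))))) nz
      where
      s1 : 1 ≤ s
      s1 = ≤-trans (s≤s z≤n) (rankIndex<shift Q s j (≰⇒> jq) js)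
      vz : v (suc Q) ≤ z
      vz with m≤n⇒m<n∨m≡n (≰⇒> jq)
      ... | inj₂ refl = <⇒≤ (subst (_< z) (sym d) wz)
      ... | inj₁ lt = <⇒≤ (<-trans (new-increasing (suc Q) j ≤-refl lt b) (subst (_< z) (sym d) wz))
    ...     | ()

  prefix : ∀ h → h ≤ suc r → Prefix h
  prefix zero _ = prefix₀
  prefix (suc h) (s≤s hr) = Step.prefix-step h hr (prefix h (m≤n⇒m≤1+n hr))

  prefix-full : Prefix (suc r)
  prefix-full = prefix (suc r) ≤-refl

  Π-inRange : InRange n l n
  Π-inRange = subst (InRange n l) (q-last n R) (proj₁ prefix-full)

  Π-distinct : Distinct l n
  Π-distinct = subst (Distinct l) (q-last n R) (proj₁ (proj₂ prefix-full))

  Π-carrelInc : ∀ k → k ≤ r → ∀ i j → q n R k < i → i < j → j ≤ q n R (suc k) → v i < v j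
  Π-carrelInc k kr i j a ij jb = Step.new-increasing k kr (prefix k (m≤n⇒m≤1+n kr)) i j a ij jb

  Π-chain312Free : Chain312Free n R (λ h x → P (q n R h) x)
  Π-chain312Free h h1 hr w z x = Step.free-step h hr (prefix h (m≤n⇒m≤1+n hr)) h1 w z x

  Π-rankTuple : IsRankTuple n R (λ h x → P (q n R h) x) γ
  Π-rankTuple i a b with carrel-of n R n1 V i a b
  ... | lo , hi , kr = Step.rank-step (below R i) kr (prefix (below R i) (m≤n⇒m≤1+n kr)) i lo hi

  Π-inSR : InSR n R (Π n R γ)
  Π-inSR = (inRange , distinct) , carrelInc
    where
    inRange : IsRTuple n (Π n R γ)
    inRange i a b = subst (λ y → 1 ≤ y × y ≤ n) (sym (Π-get n R γ i a b)) (Π-inRange i a b)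
    distinct : ∀ i j → 1 ≤ i → i ≤ n → 1 ≤ j → j ≤ n → Π n R γ ! i ≡ Π n R γ ! j → i ≡ j
    distinct i j a b c d e = Π-distinct i j a b c d (trans (sym (Π-get n R γ i a b)) (trans e (Π-get n R γ j c d)))
    carrelInc : CarrelInc n R (Π n R γ)
    carrelInc (suc k) _ (s≤s kr) i j a ij jb =
      subst₂ _<_ (sym (Π-get n R γ i (≤-trans (s≤s z≤n) a) (≤-trans (<⇒≤ ij) jb≤n)))
                 (sym (Π-get n R γ j (≤-trans (s≤s z≤n) (<-trans a ij)) jb≤n)) (Π-carrelInc k kr i j a ij jb)
      where
      jb≤n : j ≤ n
      jb≤n = ≤-trans jb (q-≤n n R n1 V (suc k) (s≤s kr))

  Π-prefixChain-free : Chain312Free n R (prefixChain n R (Π n R γ))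
  Π-prefixChain-free = subst (λ L → Chain312Free n R (λ h x → InPrefix L (q n R h) x)) (sym (toList-Π n R γ)) Π-chain312Free

  Π-prefixChain-rankTuple : IsRankTuple n R (prefixChain n R (Π n R γ)) γ
  Π-prefixChain-rankTuple = subst (λ L → IsRankTuple n R (λ h x → InPrefix L (q n R h) x) γ) (sym (toList-Π n R γ)) Π-rankTuple

module PermChains (n : ℕ) (R : List ℕ) (n1 : 1 ≤ n) (V : ValidR n R) where
  r : ℕ
  r = length R

  lenπ : ∀ (π : Vec ℕ n) h → h ≤ suc r → q n R h ≤ length (toList π)
  lenπ π h hr = subst (q n R h ≤_) (sym (len-toList π)) (q-≤n n R n1 V h hr)

  rngπ : ∀ π → IsPerm n π → ∀ k → k ≤ n → InRange n (toList π) k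
  rngπ π P k kn j a b = proj₁ P j a (≤-trans b kn)

  Dπ : ∀ π → IsPerm n π → ∀ k → k ≤ n → Distinct (toList π) k
  Dπ π P k kn j j' a b a' b' e = proj₂ P j j' a (≤-trans b kn) a' (≤-trans b' kn) e

  perm-chain : ∀ π → IsPerm n π → Chain n R (prefixChain n R π)
  perm-chain π P = mkChain (λ x → refl) csub crng ccard
    where
    csub : ∀ h → h ≤ r → ∀ x → prefixChain n R π h x ≡ true → prefixChain n R π (suc h) x ≡ true
    csub h hr x e = InPrefix-mono (toList π) (q n R h) (q n R (suc h)) (q-mono-≤ n R n1 V h (suc h) (n≤1+n h) (s≤s hr)) x e
    crng : ∀ h x → prefixChain n R π h x ≡ true → 1 ≤ x × x ≤ n
    crng h x e with memb-take-witness x (q n R h) (toList π) e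
    ... | j , a , b , c , d = subst (λ y → 1 ≤ y × y ≤ n) d (proj₁ P j a (subst (j ≤_) (len-toList π) c))
    ccard : ∀ h → h ≤ suc r → count (prefixChain n R π h) n ≡ q n R h
    ccard h hr = card-prefix n (toList π) (q n R h) (lenπ π h hr) (rngπ π P _ (q-≤n n R n1 V h hr)) (Dπ π P _ (q-≤n n R n1 V h hr))

  prefixChain-full : ∀ π → IsPerm n π → ∀ x → 1 ≤ x → x ≤ n → prefixChain n R π (suc r) x ≡ true
  prefixChain-full π P x a b = count-incl-eq (prefixChain n R π (suc r)) (λ _ → true) n (λ _ _ _ _ → refl)
    (trans (Chain.card (perm-chain π P) (suc r) ≤-refl) (trans (q-last n R) (sym (count-true n)))) x a b refl

  not-in-earlier-prefix : ∀ π → IsPerm n π → ∀ k b → k ≤ n → k < b → b ≤ n → InPrefix (toList π) k (π ! b) ≡ false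
  not-in-earlier-prefix π P k b kn kb bn with InPrefix (toList π) k (π ! b) in e
  ... | false = refl
  ... | true with memb-take-witness _ k (toList π) e
  ...   | j , a , c , d , f = ⊥-elim (<-irrefl (proj₂ P j b a (≤-trans c kn) (≤-trans (s≤s z≤n) kb) bn f) (≤-<-trans c kb))

  in-prefix-at : ∀ π k b → 1 ≤ b → b ≤ k → k ≤ n → InPrefix (toList π) k (π ! b) ≡ true
  in-prefix-at π k b a c kn = memb-take-at b k (toList π) a c (subst (b ≤_) (sym (len-toList π)) (≤-trans c kn))

  -- A 312 pattern π_b < π_c < π_a (a ≤ q_h < b ≤ q_{h+1} < c) is a forbidden triple of the chain.
  free⇒avoids312 : ∀ π → IsPerm n π → Chain312Free n R (prefixChain n R π) → ¬ Contains312 n R π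
  free⇒avoids312 π P free (h , a , b , c , (h1 , hr) , (a1 , aQ , Qb , bQ , Qc , cn) , (bc , ca)) =
    free h h1 (≤-trans (n≤1+n h) hr) (π ! b) (π ! c) (π ! a)
      (in-prefix-at π _ b (≤-trans (s≤s z≤n) Qb) bQ qsn)
      (not-in-earlier-prefix π P _ b qn Qb bn)
      (not-in-earlier-prefix π P _ c qsn Qc cn)
      (in-prefix-at π _ a a1 aQ qn) bc ca
    where
    qn : q n R h ≤ n
    qn = q-≤n n R n1 V h (≤-trans (n≤1+n h) (m≤n⇒m≤1+n hr))
    qsn : q n R (suc h) ≤ n
    qsn = q-≤n n R n1 V (suc h) (m≤n⇒m≤1+n hr)
    bn : b ≤ n
    bn = ≤-trans bQ qsn

  -- Conversely, a forbidden triple w < z < x of the chain gives a 312 pattern at the positions of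
  -- x (≤ q_h), w (in carrel h+1) and z (after q_{h+1}); for h = r no such z exists.
  avoids312⇒free : ∀ π → InSR n R π → ¬ Contains312 n R π → Chain312Free n R (prefixChain n R π)
  avoids312⇒free π (P , _) N h h1 hr w z x pw nw nz px wz zx
    with memb-take-witness w _ (toList π) pw | memb-take-witness x _ (toList π) px
       | memb-take-witness z (q n R (suc r)) (toList π) (prefixChain-full π P z z1 zn)
    where
    z1 : 1 ≤ z
    z1 = ≤-trans (s≤s z≤n) wz
    zn : z ≤ n
    zn = ≤-trans (<⇒≤ zx) (proj₂ (Chain.range (perm-chain π P) h x px))
  ... | b , b1 , bQ , _ , bw | a , a1 , aQ , _ , ax | c , c1 , cQ , _ , cz = forbidden
    where
    qh : q n R h ≤ n
    qh = q-≤n n R n1 V h (m≤n⇒m≤1+n hr)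
    qsh : q n R (suc h) ≤ n
    qsh = q-≤n n R n1 V (suc h) (s≤s hr)
    Qb : q n R h < b
    Qb with q n R h <? b
    ... | yes p = p
    ... | no np with trans (sym (subst (λ y → InPrefix (toList π) (q n R h) y ≡ true) bw (in-prefix-at π _ b b1 (≮⇒≥ np) qh))) nw
    ...   | ()
    cN : c ≤ n
    cN = subst (c ≤_) (q-last n R) cQ
    Qc : q n R (suc h) < c
    Qc with q n R (suc h) <? c
    ... | yes p = p
    ... | no np with trans (sym (subst (λ y → InPrefix (toList π) (q n R (suc h)) y ≡ true) cz (in-prefix-at π _ c c1 (≮⇒≥ np) qsh))) nz
    ...   | ()
    forbidden : ⊥
    forbidden with m≤n⇒m<n∨m≡n hr
    ... | inj₂ refl = <-irrefl refl (<-≤-trans Qc (subst (c ≤_) (sym (q-last n R)) cN))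
    ... | inj₁ hr' = N (h , a , b , c , (h1 , hr') , (a1 , aQ , Qb , bQ , Qc , cN) ,
            (subst₂ _<_ (sym bw) (sym cz) wz , subst₂ _<_ (sym cz) (sym ax) zx))

  -- If π, σ ∈ S_n^R have the same chain and agree before position i+1, then π_{i+1} ≤ σ_{i+1}:
  -- σ_{i+1} lies in the prefix set of π of its carrel, at a position j ≥ i+1 (earlier positions
  -- carry σ's earlier values), and π increases along the carrel.
  next-entry-≤ : ∀ (π σ : Vec ℕ n) → InSR n R π → InSR n R σ →
    (∀ h → h ≤ suc r → ∀ x → 1 ≤ x → x ≤ n → prefixChain n R σ h x ≡ prefixChain n R π h x) →
    ∀ i → suc i ≤ n → (∀ j → 1 ≤ j → j ≤ i → π ! j ≡ σ ! j) → π ! suc i ≤ σ ! suc i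
  next-entry-≤ π σ (Pπ , Iπ) (Pσ , Iσ) E i sin eqs with carrel-of n R n1 V (suc i) (s≤s z≤n) sin
  ... | lo , hi , kr with memb-take-witness _ _ (toList π) in-π
    where
    in-π : prefixChain n R π (suc (below R (suc i))) (σ ! suc i) ≡ true
    in-π = trans (sym (E _ (s≤s kr) (σ ! suc i) (proj₁ (proj₁ Pσ (suc i) (s≤s z≤n) sin)) (proj₂ (proj₁ Pσ (suc i) (s≤s z≤n) sin))))
                 (in-prefix-at σ _ (suc i) (s≤s z≤n) hi (q-≤n n R n1 V (suc (below R (suc i))) (s≤s kr)))
  ... | j , j1 , jQ , _ , jy with <-cmp j (suc i)
  ...   | tri≈ _ refl _ = ≤-reflexive jy
  ...   | tri< lt _ _ = ⊥-elim (<-irrefl (proj₂ Pσ j (suc i) j1 (≤-trans (<⇒≤ lt) sin) (s≤s z≤n) sin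
                                            (trans (sym (eqs j j1 (≤-pred lt))) jy)) lt)
  ...   | tri> _ _ gt = <⇒≤ (subst (π ! suc i <_) jy (Iπ (suc (below R (suc i))) (s≤s z≤n) (s≤s kr) (suc i) j lo gt jQ))

  chain-inj : ∀ π σ → InSR n R π → InSR n R σ →
    (∀ h → h ≤ suc r → ∀ x → 1 ≤ x → x ≤ n → prefixChain n R π h x ≡ prefixChain n R σ h x) → π ≡ σ
  chain-inj π σ Sπ Sσ E = vec-ext π σ (λ i a b → agree-upto i b i a ≤-refl)
    where
    agree-upto : ∀ i → i ≤ n → ∀ j → 1 ≤ j → j ≤ i → π ! j ≡ σ ! j
    agree-upto zero _ (suc j) a ()
    agree-upto (suc i) sin j a b with m≤n⇒m<n∨m≡n b
    ... | inj₁ (s≤s lt) = agree-upto i (≤-trans (n≤1+n i) sin) j a lt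
    ... | inj₂ refl = ≤-antisym
      (next-entry-≤ π σ Sπ Sσ (λ h hr x a b → sym (E h hr x a b)) i sin (agree-upto i (≤-trans (n≤1+n i) sin)))
      (next-entry-≤ σ π Sσ Sπ E i sin (λ j a b → sym (agree-upto i (≤-trans (n≤1+n i) sin) j a b)))

module Reconstruction (n : ℕ) (R : List ℕ) (n1 : 1 ≤ n) (V : ValidR n R) (B : ℕ → ℕ → Bool)
                      (ch : Chain n R B) (free : Chain312Free n R B) (γ : Vec ℕ n) (sel : IsRankTuple n R B γ) where
  open RankTuples n R n1 V B γ sel using (rankTuple-at; top-free-in-next; rankTuple-gapless)
  open PiOfGapless n R n1 V γ (rankTuple-gapless ch free)

  shifted-in-next : ∀ h → h ≤ r → (I : Prefix h) → (∀ x → 1 ≤ x → x ≤ n → P (q n R h) x ≡ B h x) →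
    ∀ j → (a : q n R h < j) → (b : j ≤ q n R h + shift h) → B (suc h) (v j) ≡ true
  shifted-in-next h hr I agree j a b =
    top-free-in-next ch free h h1 hr yM (v j) J.d old J.vM count-above
      (subst (J.d <_) (shift-yes h (≤ᵇ-true _ _ yM)) (rankIndex<shift (q n R h) (shift h) j a b))
    where
    module J = Step.Shifted h hr I j a b
    h1 : 1 ≤ h
    h1 = proj₁ (shift-facts h hr J.s1)
    yM : γ ! suc (q n R h) ≤ top h
    yM = proj₁ (proj₂ (shift-facts h hr J.s1))
    M≤n : top h ≤ n
    M≤n = top≤n h (m≤n⇒m≤1+n hr)
    old : B h (v j) ≡ false
    old = trans (sym (agree (v j) J.v1 (≤-trans J.vM M≤n))) (not-true _ J.vA)
    outside-agree : ∀ g → g ≤ n → count (avail h) g ≡ count (λ z → not (B h z)) g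
    outside-agree g gn = count-ext _ _ g (λ z p1 p2 → cong not (agree z p1 (≤-trans p2 gn)))
    count-above : count (λ z → not (B h z)) (top h) ≡ J.d + count (λ z → not (B h z)) (v j)
    count-above = trans (sym (outside-agree (top h) M≤n))
                        (trans J.vc (cong (J.d +_) (outside-agree (v j) (≤-trans J.vM M≤n))))

  -- The prefix chain of Π(γ) is B, by induction on the level: the prefix set of length q_{h+1}
  -- lies in B_{h+1} (old values by induction, shifted values by 'shifted-in-next', kept values
  -- by the rank property of γ), and both sets have q_{h+1} elements.
  reconstruct : ∀ h → h ≤ suc r → ∀ x → 1 ≤ x → x ≤ n → P (q n R h) x ≡ B h x
  reconstruct zero _ x a b = sym (Chain.empty ch x)
  reconstruct (suc h) (s≤s hr) x a b = bool-ext _ _ (prefix⊆B x a b) (B⊆prefix x a b)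
    where
    Q Q' : ℕ
    Q = q n R h
    Q' = q n R (suc h)
    agree : ∀ x → 1 ≤ x → x ≤ n → P Q x ≡ B h x
    agree = reconstruct h (m≤n⇒m≤1+n hr)
    I : Prefix h
    I = prefix h (m≤n⇒m≤1+n hr)
    I' : Prefix (suc h)
    I' = prefix (suc h) (s≤s hr)
    prefix⊆B : Incl (P Q') (B (suc h)) n
    prefix⊆B x a b e with memb-take-witness x Q' l e
    ... | j , j1 , jQ' , _ , jx with j ≤? Q
    ...   | yes c = Chain.mono ch h hr x (trans (sym (agree x a b))
                      (subst (λ z → P Q z ≡ true) jx (memb-take-at j Q l j1 c (≤-trans c (q≤length h (m≤n⇒m≤1+n hr))))))
    ...   | no c with j ≤? Q + shift h
    ...     | no c' = subst (λ z → B (suc h) z ≡ true) (trans (sym (Step.Kept.veq h hr I j (≰⇒> c') jQ')) jx)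
                        (proj₁ (rankTuple-at h j hr (≰⇒> c) jQ'))
    ...     | yes c' = subst (λ z → B (suc h) z ≡ true) jx (shifted-in-next h hr I agree j (≰⇒> c) c')
    B⊆prefix : Incl (B (suc h)) (P Q') n
    B⊆prefix = count-incl-eq (P Q') (B (suc h)) n prefix⊆B
      (trans (card-prefix n l Q' (q≤length (suc h) (s≤s hr)) (proj₁ I') (proj₁ (proj₂ I')))
             (sym (Chain.card ch (suc h) (s≤s hr))))

  Π-prefixChain : ∀ h → h ≤ suc r → ∀ x → 1 ≤ x → x ≤ n → prefixChain n R (Π n R γ) h x ≡ B h x
  Π-prefixChain h hr x a b = trans (cong (λ L → InPrefix L (q n R h) x) (toList-Π n R γ)) (reconstruct h hr x a b)

SeparatedRuns : ℕ → List (ℕ × ℕ) → Set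
SeparatedRuns m [] = ⊤
SeparatedRuns m ((a , b) ∷ L) = m ≤ a × a ≤ b × SeparatedRuns (suc (suc b)) L

-- Invariant of the scan performed by runs: the open run (if any) started before the current position.
OpenValid : Maybe ℕ → ℕ → ℕ → Set
OpenValid nothing k m = m ≤ k
OpenValid (just a) k m = m ≤ a × a < k

runs-good : ∀ bs k o m → 1 ≤ k → OpenValid o k m → SeparatedRuns m (runs k o bs)
runs-good [] k nothing m k1 ok = tt
runs-good [] (suc k) (just a) m k1 (ma , s≤s ak) = ma , ak , tt
runs-good (true ∷ bs) k nothing m k1 ok = runs-good bs (suc k) (just k) m (s≤s z≤n) (ok , ≤-refl)
runs-good (false ∷ bs) k nothing m k1 ok = runs-good bs (suc k) nothing m (s≤s z≤n) (m≤n⇒m≤1+n ok)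
runs-good (true ∷ bs) k (just a) m k1 (ma , ak) = runs-good bs (suc k) (just a) m (s≤s z≤n) (ma , m≤n⇒m≤1+n ak)
runs-good (false ∷ bs) (suc k) (just a) m k1 (ma , s≤s ak) = ma , ak , runs-good bs (suc (suc k)) nothing (suc (suc k)) (s≤s z≤n) ≤-refl

-- The bit for integer x in a bit list whose head stands for integer k.
bitAt : ℕ → List Bool → ℕ → Bool
bitAt k bs x = get false bs (suc (x ∸ k))

bitAt-here : ∀ k b bs → bitAt k (b ∷ bs) k ≡ b
bitAt-here k b bs rewrite n∸n≡0 k = refl

bitAt-there : ∀ k b bs x → k < x → bitAt k (b ∷ bs) x ≡ bitAt (suc k) bs x
bitAt-there k b bs x lt rewrite ∸suc' lt = refl

OpenContains : Maybe ℕ → ℕ → ℕ → Set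
OpenContains nothing k x = ⊥
OpenContains (just a) k x = a ≤ x × x < k

BitSet : ℕ → List Bool → ℕ → Set
BitSet k bs x = k ≤ x × bitAt k bs x ≡ true

runs-cov→ : ∀ bs k o x → 1 ≤ k → InUnion x (runs k o bs) → OpenContains o k x ⊎ BitSet k bs x
runs-cov→ [] k nothing x k1 ()
runs-cov→ [] k (just a) x k1 (here (p , q')) = inj₁ (p , ≤pred⇒< k1 q')
runs-cov→ [] k (just a) x k1 (there ())
runs-cov→ (true ∷ bs) k nothing x k1 u with runs-cov→ bs (suc k) (just k) x (s≤s z≤n) u
... | inj₁ (p , s≤s q') with ≤-antisym p q'
...   | refl = inj₂ (≤-refl , bitAt-here x true bs)
runs-cov→ (true ∷ bs) k nothing x k1 u | inj₂ (p , q') = inj₂ (<⇒≤ p , trans (bitAt-there k true bs x p) q')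
runs-cov→ (false ∷ bs) k nothing x k1 u with runs-cov→ bs (suc k) nothing x (s≤s z≤n) u
... | inj₂ (p , q') = inj₂ (<⇒≤ p , trans (bitAt-there k false bs x p) q')
runs-cov→ (true ∷ bs) k (just a) x k1 u with runs-cov→ bs (suc k) (just a) x (s≤s z≤n) u
... | inj₁ (p , s≤s q') with m≤n⇒m<n∨m≡n q'
...   | inj₁ lt = inj₁ (p , lt)
...   | inj₂ refl = inj₂ (≤-refl , bitAt-here x true bs)
runs-cov→ (true ∷ bs) k (just a) x k1 u | inj₂ (p , q') = inj₂ (<⇒≤ p , trans (bitAt-there k true bs x p) q')
runs-cov→ (false ∷ bs) k (just a) x k1 (here (p , q')) = inj₁ (p , ≤pred⇒< k1 q')
runs-cov→ (false ∷ bs) k (just a) x k1 (there u) with runs-cov→ bs (suc k) nothing x (s≤s z≤n) u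
... | inj₂ (p , q') = inj₂ (<⇒≤ p , trans (bitAt-there k false bs x p) q')

runs-cov← : ∀ bs k o x → 1 ≤ k → OpenValid o k 0 → OpenContains o k x ⊎ BitSet k bs x → InUnion x (runs k o bs)
runs-cov← [] k nothing x k1 ok (inj₂ (p , ()))
runs-cov← [] k (just a) x k1 ok (inj₁ (p , q')) = here (p , <⇒≤pred q')
runs-cov← [] k (just a) x k1 ok (inj₂ (p , ()))
runs-cov← (true ∷ bs) k nothing x k1 ok (inj₂ (p , q')) with m≤n⇒m<n∨m≡n p
... | inj₂ refl = runs-cov← bs (suc k) (just k) k (s≤s z≤n) (z≤n , ≤-refl) (inj₁ (≤-refl , ≤-refl))
... | inj₁ lt = runs-cov← bs (suc k) (just k) x (s≤s z≤n) (z≤n , ≤-refl) (inj₂ (lt , trans (sym (bitAt-there k true bs x lt)) q'))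
runs-cov← (false ∷ bs) k nothing x k1 ok (inj₂ (p , q')) with m≤n⇒m<n∨m≡n p
... | inj₂ refl with trans (sym (bitAt-here k false bs)) q'
...   | ()
runs-cov← (false ∷ bs) k nothing x k1 ok (inj₂ (p , q')) | inj₁ lt =
  runs-cov← bs (suc k) nothing x (s≤s z≤n) z≤n (inj₂ (lt , trans (sym (bitAt-there k false bs x lt)) q'))
runs-cov← (true ∷ bs) k (just a) x k1 (_ , ak) (inj₁ (p , q')) =
  runs-cov← bs (suc k) (just a) x (s≤s z≤n) (z≤n , m≤n⇒m≤1+n ak) (inj₁ (p , m≤n⇒m≤1+n q'))
runs-cov← (true ∷ bs) k (just a) x k1 (_ , ak) (inj₂ (p , q')) with m≤n⇒m<n∨m≡n p
... | inj₂ refl = runs-cov← bs (suc k) (just a) k (s≤s z≤n) (z≤n , m≤n⇒m≤1+n ak) (inj₁ (<⇒≤ ak , ≤-refl))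
... | inj₁ lt = runs-cov← bs (suc k) (just a) x (s≤s z≤n) (z≤n , m≤n⇒m≤1+n ak) (inj₂ (lt , trans (sym (bitAt-there k true bs x lt)) q'))
runs-cov← (false ∷ bs) k (just a) x k1 ok (inj₁ (p , q')) = here (p , <⇒≤pred q')
runs-cov← (false ∷ bs) k (just a) x k1 ok (inj₂ (p , q')) with m≤n⇒m<n∨m≡n p
... | inj₂ refl with trans (sym (bitAt-here k false bs)) q'
...   | ()
runs-cov← (false ∷ bs) k (just a) x k1 ok (inj₂ (p , q')) | inj₁ lt =
  there (runs-cov← bs (suc k) nothing x (s≤s z≤n) z≤n (inj₂ (lt , trans (sym (bitAt-there k false bs x lt)) q')))

clump-good : ∀ {n} (S : Subset n) → SeparatedRuns 1 (clumps S)
clump-good S = runs-good (toList S) 1 nothing 1 ≤-refl ≤-refl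

clump→ : ∀ {n} (S : Subset n) x → InUnion x (clumps S) → (x ∈S S) ≡ true
clump→ S x u with runs-cov→ (toList S) 1 nothing x ≤-refl u
... | inj₂ (s≤s z≤n , q') = q'

clump← : ∀ {n} (S : Subset n) x → (x ∈S S) ≡ true → InUnion x (clumps S)
clump← S x e with ∈S-range S x e
... | s≤s z≤n , _ = runs-cov← (toList S) 1 nothing x ≤-refl z≤n (inj₂ (s≤s z≤n , e))

HeadContains : ℕ → List (ℕ × ℕ) → Set
HeadContains w [] = ⊥
HeadContains w ((a , b) ∷ L) = a ≤ w × w ≤ b

runs-lower-bound : ∀ m L x → SeparatedRuns m L → InUnion x L → m ≤ x
runs-lower-bound m ((a , b) ∷ L) x (ma , ab , g) (here (p , _)) = ≤-trans ma p
runs-lower-bound m ((a , b) ∷ L) x (ma , ab , g) (there u) = ≤-trans ma (≤-trans ab (≤-trans (n≤1+n b) (≤-trans (n≤1+n _) (runs-lower-bound _ L x g u))))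

drop-union : ∀ x e L → InUnion x (drop e L) → InUnion x L
drop-union x zero L u = u
drop-union x (suc e) [] ()
drop-union x (suc e) (I ∷ L) u = there (drop-union x e L u)

head-union : ∀ w L → HeadContains w L → InUnion w L
head-union w ((a , b) ∷ L) h = here h

runs-after-gap : ∀ m L e w z x → SeparatedRuns m L → InUnion w (drop e L) → ¬ InUnion z L → w < z → z < x → InUnion x L → InUnion x (drop (suc e) L)
runs-after-gap m ((a , b) ∷ L) zero w z x g (here (aw , wb)) nz wz zx (here (ax , xb)) = ⊥-elim (nz (here (≤-trans aw (<⇒≤ wz) , ≤-trans (<⇒≤ zx) xb)))
runs-after-gap m ((a , b) ∷ L) zero w z x g _ nz wz zx (there u) = u
runs-after-gap m ((a , b) ∷ L) zero w z x (_ , _ , g) (there uw) nz wz zx (here (ax , xb)) =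
  ⊥-elim (<-irrefl refl (≤-<-trans xb (<-trans (≤-trans (n≤1+n _) (runs-lower-bound _ L w g uw)) (<-trans wz zx))))
runs-after-gap m ((a , b) ∷ L) (suc e) w z x (_ , _ , g) uw nz wz zx (here (ax , xb)) =
  ⊥-elim (<-irrefl refl (≤-<-trans xb (<-trans (≤-trans (n≤1+n _) (runs-lower-bound _ L w g (drop-union w e L uw))) (<-trans wz zx))))
runs-after-gap m ((a , b) ∷ L) (suc e) w z x (_ , _ , g) uw nz wz zx (there ux) = runs-after-gap _ L e w z x g uw (λ u → nz (there u)) wz zx ux

runs-tail-from : ∀ m L e w x → SeparatedRuns m L → HeadContains w (drop e L) → InUnion x L → w ≤ x → InUnion x (drop e L)
runs-tail-from m L zero w x g hw ux wx = ux
runs-tail-from m ((a , b) ∷ L) (suc e) w x (_ , _ , g) hw (here (ax , xb)) wx =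
  ⊥-elim (<-irrefl refl (≤-<-trans xb (≤-trans (n≤1+n _) (≤-trans (runs-lower-bound _ L w g (drop-union w e L (head-union w (drop e L) hw))) wx))))
runs-tail-from m ((a , b) ∷ L) (suc e) w x (_ , _ , g) hw (there ux) wx = runs-tail-from _ L e w x g hw ux wx

runs-gap-between : ∀ m L e w x → SeparatedRuns m L → HeadContains w (drop e L) → InUnion x (drop (suc e) L) → Σ ℕ λ z → ¬ InUnion z L × w < z × z < x
runs-gap-between m ((a , b) ∷ L) zero w x (_ , _ , g) (aw , wb) ux = suc b , nz , s≤s wb , runs-lower-bound _ L x g ux
  where
  nz : ¬ InUnion (suc b) ((a , b) ∷ L)
  nz (here (_ , p)) = <-irrefl refl p
  nz (there u) = <-irrefl refl (runs-lower-bound _ L (suc b) g u)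
runs-gap-between m ((a , b) ∷ L) (suc e) w x (_ , _ , g) hw ux with runs-gap-between _ L e w x g hw ux
... | z , nz , wz , zx = z , nz' , wz , zx
  where
  wL : suc (suc b) ≤ w
  wL = runs-lower-bound _ L w g (drop-union w e L (head-union w (drop e L) hw))
  nz' : ¬ InUnion z ((a , b) ∷ L)
  nz' (here (_ , p)) = <-irrefl refl (≤-<-trans p (<-trans (n<1+n b) (<-≤-trans wL (<⇒≤ wz))))
  nz' (there u) = nz u

runs-position : ∀ w L → InUnion w L → Σ ℕ λ e → e < length L × HeadContains w (drop e L)
runs-position w (I ∷ L) (here p) = 0 , s≤s z≤n , p
runs-position w (I ∷ L) (there u) with runs-position w L u
... | e , lt , h = suc e , s≤s lt , h

chainPred : ∀ {n} → List (Subset n) → ℕ → ℕ → Bool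
chainPred Bs h x = x ∈S Bget Bs h

module ClumpGlue (n : ℕ) (R : List ℕ) (n1 : 1 ≤ n) (V : ValidR n R) where
  open PermChains n R n1 V

  Bget-top : ∀ (Bs : List (Subset n)) → length Bs ≡ r → Bget Bs (suc r) ≡ S.⊤
  Bget-top Bs e = get-beyond S.⊤ Bs (suc r) (subst (_< suc r) (sym e) ≤-refl)

  length-chainOf : ∀ π → length (chainOf n R π) ≡ r
  length-chainOf π = LP.length-map (λ qh → prefixSet qh π) R

  rankTuple-transfer : ∀ B B' γ → IsRankTuple n R B γ → (∀ h x → B h x ≡ true → 1 ≤ x × x ≤ n) →
    (∀ h → h ≤ suc r → ∀ x → 1 ≤ x → x ≤ n → B h x ≡ B' h x) → IsRankTuple n R B' γ
  rankTuple-transfer B B' γ sel rng E i a b with carrel-of n R n1 V i a b | sel i a b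
  ... | _ , _ , kr | m , c = trans (sym (E k (s≤s kr) x (proj₁ xr) (proj₂ xr))) m ,
      trans (sym (count-ext _ _ x (λ y p1 p2 → E k (s≤s kr) y p1 (≤-trans p2 (proj₂ xr))))) c
    where
    k x : ℕ
    k = suc (below R i)
    x = γ ! i
    xr : 1 ≤ x × x ≤ n
    xr = rng k x m

  -- ... and a chain has at most one rank tuple, since elements are determined by their counts.
  rankTuple-unique : ∀ B γ γ' → IsRankTuple n R B γ → IsRankTuple n R B γ' → γ ≡ γ'
  rankTuple-unique B γ γ' s s' = vec-ext γ γ' (λ i a b → count-injective _ (proj₁ (s i a b)) (proj₁ (s' i a b)) (trans (proj₂ (s i a b)) (sym (proj₂ (s' i a b)))))

  chainOf-agrees : ∀ π → IsPerm n π → ∀ h → h ≤ suc r → ∀ x → 1 ≤ x → x ≤ n → chainPred (chainOf n R π) h x ≡ prefixChain n R π h x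
  chainOf-agrees π P zero _ x a b = ∈S-⊥ {n} x
  chainOf-agrees π P (suc k) hr x a b with m≤n⇒m<n∨m≡n hr
  ... | inj₂ refl rewrite Bget-top (chainOf n R π) (length-chainOf π) = trans (∈S-⊤ x a b) (sym (prefixChain-full π P x a b))
  ... | inj₁ (s≤s kr) rewrite get-map (λ qh → prefixSet qh π) S.⊤ n R k kr =
        get-tab false n (λ y → memb y (take (q n R (suc k)) (toList π))) x a b

  prefixSet-member : ∀ (π : Vec ℕ n) k x → 1 ≤ x → x ≤ n → (x ∈S prefixSet k π) ≡ InPrefix (toList π) k x
  prefixSet-member π k x a b = get-tab false n (λ y → memb y (take k (toList π))) x a b

  chainPred-range : ∀ (Bs : List (Subset n)) h x → chainPred Bs h x ≡ true → 1 ≤ x × x ≤ n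
  chainPred-range Bs h x e = ∈S-range (Bget Bs h) x e

  free-transfer : ∀ B B' → (∀ h x → B' h x ≡ true → 1 ≤ x × x ≤ n) →
    (∀ h → h ≤ suc r → ∀ x → 1 ≤ x → x ≤ n → B h x ≡ B' h x) → Chain312Free n R B → Chain312Free n R B'
  free-transfer B B' rng E free h h1 hr w z x pw nw nz px wz zx =
    free h h1 hr w z x (tr (suc h) (s≤s hr) w wr pw) (tr' h (m≤n⇒m≤1+n hr) w wr nw) (tr' (suc h) (s≤s hr) z zr nz)
       (tr h (m≤n⇒m≤1+n hr) x xr px) wz zx
    where
    wr : 1 ≤ w × w ≤ n
    wr = rng (suc h) w pw
    xr : 1 ≤ x × x ≤ n
    xr = rng h x px
    zr : 1 ≤ z × z ≤ n
    zr = ≤-trans (proj₁ wr) (<⇒≤ wz) , ≤-trans (<⇒≤ zx) (proj₂ xr)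
    tr : ∀ h → h ≤ suc r → ∀ y → 1 ≤ y × y ≤ n → B' h y ≡ true → B h y ≡ true
    tr h hr y (a , b) e = trans (E h hr y a b) e
    tr' : ∀ h → h ≤ suc r → ∀ y → 1 ≤ y × y ≤ n → B' h y ≡ false → B h y ≡ false
    tr' h hr y (a , b) e = trans (E h hr y a b) e

  -- A chain level strictly grows, so B_{h+1} ∖ B_h has a least element.
  least-new : ∀ (Bs : List (Subset n)) → Chain n R (chainPred Bs) → ∀ h → h ≤ r →
    Σ ℕ λ w → (w ∈S Bget Bs (suc h)) ≡ true × (w ∈S Bget Bs h) ≡ false ×
      (∀ u → u < w → ((u ∈S Bget Bs (suc h)) ∧ not (u ∈S Bget Bs h)) ≡ false)
  least-new Bs ch h hr with count-witness (chainPred Bs h) (chainPred Bs (suc h)) n (λ z _ _ → Chain.mono ch h hr z) bigger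
    where
    bigger : count (chainPred Bs h) n < count (chainPred Bs (suc h)) n
    bigger = subst₂ _<_ (sym (Chain.card ch h (m≤n⇒m≤1+n hr))) (sym (Chain.card ch (suc h) (s≤s hr)))
                        (q-mono n R n1 V h (suc h) ≤-refl (s≤s hr))
  ... | w , _ , _ , new , old with min-find (λ x → (x ∈S Bget Bs (suc h)) ∧ not (x ∈S Bget Bs h)) w (cong₂ _∧_ new (cong not old))
  ...   | w0 , Dw0 , minimal = w0 , proj₁ (∧-true _ _ Dw0) , not-true _ (proj₂ (∧-true _ _ Dw0)) , minimal

  -- A 312-free chain is rightmost clump deleting: for the clump e of the least new element w₀,
  -- every new element lies in clumps e, e+1, … (it is ≥ w₀), and the clumps after e are wholly
  -- new (an old x there, with a gap z between w₀ and x, would form a forbidden triple).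
  free⇒clumpDeleting : ∀ (Bs : List (Subset n)) → Chain n R (chainPred Bs) → Chain312Free n R (chainPred Bs) →
    ∀ h → 1 ≤ h → h ≤ r →
     let Ls = clumps (Bget Bs (suc h))
         D  = λ x → (x ∈S Bget Bs (suc h)) ∧ not (x ∈S Bget Bs h)
     in Σ ℕ λ e → e < length Ls ×
          (∀ x → D x ≡ true → InUnion x (drop e Ls)) ×
          (∀ x → InUnion x (drop (suc e) Ls) → D x ≡ true)
  free⇒clumpDeleting Bs ch free h h1 hr with least-new Bs ch h hr
  ... | w0 , w0new , w0old , minimal with runs-position w0 (clumps (Bget Bs (suc h))) (clump← (Bget Bs (suc h)) w0 w0new)
  ...   | e , e<f , head = e , e<f , from-head , later-new
    where
    S' S0 : Subset n
    S' = Bget Bs (suc h)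
    S0 = Bget Bs h
    from-head : ∀ x → ((x ∈S S') ∧ not (x ∈S S0)) ≡ true → InUnion x (drop e (clumps S'))
    from-head x Dx = runs-tail-from 1 (clumps S') e w0 x (clump-good S') head (clump← S' x (proj₁ (∧-true _ _ Dx))) w0≤x
      where
      w0≤x : w0 ≤ x
      w0≤x with w0 ≤? x
      ... | yes p = p
      ... | no np with trans (sym Dx) (minimal x (≰⇒> np))
      ...   | ()
    later-new : ∀ x → InUnion x (drop (suc e) (clumps S')) → ((x ∈S S') ∧ not (x ∈S S0)) ≡ true
    later-new x u with runs-gap-between 1 (clumps S') e w0 x (clump-good S') head u
    ... | z , z∉ , w0<z , z<x with x ∈S S0 in old
    ...   | false = cong (λ b → b ∧ true) (clump→ S' x (drop-union x (suc e) (clumps S') u))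
    ...   | true = ⊥-elim (free h h1 hr w0 z x w0new w0old z∉S' old w0<z z<x)
      where
      z∉S' : (z ∈S S') ≡ false
      z∉S' with z ∈S S' in ez
      ... | false = refl
      ... | true = ⊥-elim (z∉ (clump← S' z ez))

  -- Conversely, in a rightmost clump deleting chain a forbidden triple w < z < x is impossible:
  -- w is new, hence in clump e or later, so x lies beyond the gap z in a later clump, which is
  -- wholly new, contradicting x ∈ B_h.
  clumpDeleting⇒free : ∀ (Bs : List (Subset n)) → RCD n R Bs → Chain312Free n R (chainPred Bs)
  clumpDeleting⇒free Bs (ic , cl) h h1 hr w z x pw nw nz px wz zx with cl h h1 hr
  ... | e , elt , c1 , c2 = absurd (c2 x (runs-after-gap 1 Ls e w z x (clump-good S') (c1 w Dw) nzL wz zx xL))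
    where
    S' : Subset n
    S' = Bget Bs (suc h)
    Ls : List (ℕ × ℕ)
    Ls = clumps S'
    Dw : ((w ∈S S') ∧ not (w ∈S Bget Bs h)) ≡ true
    Dw rewrite pw | nw = refl
    nzL : ¬ InUnion z Ls
    nzL u with trans (sym (clump→ S' z u)) nz
    ... | ()
    xL : InUnion x Ls
    xL = clump← S' x (⊆-to _ _ (proj₁ (proj₂ ic) h hr) x px)
    absurd : ((x ∈S S') ∧ not (x ∈S Bget Bs h)) ≡ true → ⊥
    absurd e' with trans (sym px) (not-true _ (proj₂ (∧-true _ _ e')))
    ... | ()

  clumpDeleting-chain : ∀ (Bs : List (Subset n)) → RCD n R Bs → Chain n R (chainPred Bs)
  clumpDeleting-chain Bs ((len , sub , card) , _) = mkChain (λ x → ∈S-⊥ {n} x) (λ h hr x e → ⊆-to _ _ (sub h hr) x e) (chainPred-range Bs) cc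
    where
    cc : ∀ h → h ≤ suc r → count (chainPred Bs h) n ≡ q n R h
    cc zero _ = count-none _ n (λ w _ _ → ∈S-⊥ {n} w)
    cc (suc k) hr with m≤n⇒m<n∨m≡n hr
    ... | inj₁ (s≤s kr) = trans (sym (card-count (Bget Bs (suc k)))) (card (suc k) (s≤s z≤n) kr)
    ... | inj₂ refl = trans (count-ext _ _ n (λ y a b → trans (cong (y ∈S_) (Bget-top Bs len)) (∈S-⊤ y a b)))
                        (trans (count-true n) (sym (q-last n R)))

  chainOf-chain : ∀ π → IsPerm n π → Chain n R (chainPred (chainOf n R π))
  chainOf-chain π P = mkChain (λ x → ∈S-⊥ {n} x) mono (chainPred-range (chainOf n R π)) card
    where
    mono : ∀ h → h ≤ r → ∀ x → chainPred (chainOf n R π) h x ≡ true → chainPred (chainOf n R π) (suc h) x ≡ true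
    mono h hr x e with chainPred-range (chainOf n R π) h x e
    ... | a , b = trans (chainOf-agrees π P (suc h) (s≤s hr) x a b)
                        (Chain.mono (perm-chain π P) h hr x (trans (sym (chainOf-agrees π P h (m≤n⇒m≤1+n hr) x a b)) e))
    card : ∀ h → h ≤ suc r → count (chainPred (chainOf n R π) h) n ≡ q n R h
    card h hr = trans (count-ext _ _ n (λ x a b → chainOf-agrees π P h hr x a b)) (Chain.card (perm-chain π P) h hr)

  chainOf-free : ∀ π → InSR n R π → ¬ Contains312 n R π → Chain312Free n R (chainPred (chainOf n R π))
  chainOf-free π S N = free-transfer (prefixChain n R π) (chainPred (chainOf n R π)) (chainPred-range (chainOf n R π))
    (λ h hr x a b → sym (chainOf-agrees π (proj₁ S) h hr x a b)) (avoids312⇒free π S N)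

  chainPred-isChain : ∀ Bs → Chain n R (chainPred Bs) → length Bs ≡ r → IsChain n R Bs
  chainPred-isChain Bs ch len = len , (λ h hr → ⊆-from _ _ (Chain.mono ch h hr)) ,
    (λ h h1 hr → trans (card-count (Bget Bs h)) (Chain.card ch h (m≤n⇒m≤1+n hr)))

  chainOf-from-pred : ∀ π Bs → length Bs ≡ r →
    (∀ h → h ≤ suc r → ∀ x → 1 ≤ x → x ≤ n → prefixChain n R π h x ≡ chainPred Bs h x) → chainOf n R π ≡ Bs
  chainOf-from-pred π Bs len agree = list-ext S.⊤ (chainOf n R π) Bs (trans (length-chainOf π) (sym len)) same
    where
    same : ∀ j → 1 ≤ j → j ≤ length (chainOf n R π) → get S.⊤ (chainOf n R π) j ≡ get S.⊤ Bs j
    same (suc k) _ jl = trans (get-map (λ qh → prefixSet qh π) S.⊤ n R k kr)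
      (bvec-ext _ _ (λ x a b → trans (prefixSet-member π (q n R (suc k)) x a b) (agree (suc k) (m≤n⇒m≤1+n kr) x a b)))
      where
      kr : suc k ≤ r
      kr = subst (suc k ≤_) (length-chainOf π) jl

module Main (n : ℕ) (n1 : 1 ≤ n) (R : List ℕ) (V : ValidR n R) where
  open PermChains n R n1 V
  open ClumpGlue n R n1 V

  Ψ-rankTuple : ∀ π → IsPerm n π → IsRankTuple n R (prefixChain n R π) (Ψ n R π)
  Ψ-rankTuple π P = rankTuple-transfer (λ h x → x ∈S prefixSet (q n R h) π) (prefixChain n R π) (Ψ n R π)
    (rankTuple-isRankTuple n R n1 V (λ h → prefixSet (q n R h) π) card)
    (λ h x e → ∈S-range (prefixSet (q n R h) π) x e) (λ h hr x a b → prefixSet-member π (q n R h) x a b)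
    where
    card : ∀ h → 1 ≤ h → h ≤ suc r → count (λ x → x ∈S prefixSet (q n R h) π) n ≡ q n R h
    card h h1 hr = trans (count-ext _ _ n (λ x a b → prefixSet-member π (q n R h) x a b)) (Chain.card (perm-chain π P) h hr)

  -- (ii) Ψ_R maps S_n^{R-312} into UG_R(n): the prefix chain of π is 312-free.
  Ψ-gapless : (π : Vec ℕ n) → InSR312 n R π → InUG n R (Ψ n R π)
  Ψ-gapless π (S , N) = RankTuples.rankTuple-gapless n R n1 V (prefixChain n R π) (Ψ n R π)
    (Ψ-rankTuple π (proj₁ S)) (perm-chain π (proj₁ S)) (avoids312⇒free π S N)

  Π-avoids312 : (γ : Vec ℕ n) → InUG n R γ → InSR312 n R (Π n R γ)
  Π-avoids312 γ ug = Π-inSR , free⇒avoids312 (Π n R γ) (proj₁ Π-inSR) Π-prefixChain-free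
    where open PiOfGapless n R n1 V γ ug

  -- (ii) Π_R ∘ Ψ_R = id: Π_R(Ψ_R(π)) has the same prefix chain as π.
  Π∘Ψ : (π : Vec ℕ n) → InSR312 n R π → Π n R (Ψ n R π) ≡ π
  Π∘Ψ π (S , N) = chain-inj (Π n R γ) π (proj₁ (Π-avoids312 γ (Ψ-gapless π (S , N)))) S
    (Reconstruction.Π-prefixChain n R n1 V (prefixChain n R π) (perm-chain π (proj₁ S)) (avoids312⇒free π S N) γ
      (Ψ-rankTuple π (proj₁ S)))
    where
    γ : Vec ℕ n
    γ = Ψ n R π

  -- (ii) Ψ_R ∘ Π_R = id: γ is the rank tuple of the prefix chain of Π_R(γ).
  Ψ∘Π : (γ : Vec ℕ n) → InUG n R γ → Ψ n R (Π n R γ) ≡ γ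
  Ψ∘Π γ ug = rankTuple-unique (prefixChain n R (Π n R γ)) (Ψ n R (Π n R γ)) γ
    (Ψ-rankTuple (Π n R γ) (proj₁ Π-inSR)) Π-prefixChain-rankTuple
    where open PiOfGapless n R n1 V γ ug

  chainOf-RCD : (π : Vec ℕ n) → InSR312 n R π → RCD n R (chainOf n R π)
  chainOf-RCD π (S , N) = chainPred-isChain (chainOf n R π) (chainOf-chain π (proj₁ S)) (length-chainOf π) ,
    free⇒clumpDeleting (chainOf n R π) (chainOf-chain π (proj₁ S)) (chainOf-free π S N)

  chainOf-injective : (π σ : Vec ℕ n) → InSR312 n R π → InSR312 n R σ → chainOf n R π ≡ chainOf n R σ → π ≡ σ
  chainOf-injective π σ (Sπ , _) (Sσ , _) e = chain-inj π σ Sπ Sσ λ h hr x a b →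
    trans (sym (chainOf-agrees π (proj₁ Sπ) h hr x a b))
          (trans (cong (λ Bs → chainPred Bs h x) e) (chainOf-agrees σ (proj₁ Sσ) h hr x a b))

  -- (i) Every rightmost clump deleting chain is the chain of Π_R of its rank tuple.
  chainOf-onto : (Bs : List (Subset n)) → RCD n R Bs → Σ (Vec ℕ n) (λ π → InSR312 n R π × chainOf n R π ≡ Bs)
  chainOf-onto Bs rcd = Π n R γ , Π-avoids312 γ ug ,
    chainOf-from-pred (Π n R γ) Bs (proj₁ (proj₁ rcd)) λ h hr x a b →
      Reconstruction.Π-prefixChain n R n1 V (chainPred Bs) ch free γ ranks h hr x a b
    where
    ch : Chain n R (chainPred Bs)
    ch = clumpDeleting-chain Bs rcd
    free : Chain312Free n R (chainPred Bs)
    free = clumpDeleting⇒free Bs rcd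
    γ : Vec ℕ n
    γ = rankTuple n R (Bget Bs)
    ranks : IsRankTuple n R (chainPred Bs) γ
    ranks = rankTuple-isRankTuple n R n1 V (Bget Bs) (λ h h1 hr → Chain.card ch h hr)
    ug : InUG n R γ
    ug = RankTuples.rankTuple-gapless n R n1 V (chainPred Bs) γ ranks ch free

proposition6p6 : (n : ℕ) → 1 ≤ n → (R : List ℕ) → ValidR n R →
    ((π : Vec ℕ n) → InSR312 n R π → RCD n R (chainOf n R π))
    × ((π σ : Vec ℕ n) → InSR312 n R π → InSR312 n R σ → chainOf n R π ≡ chainOf n R σ → π ≡ σ)
    × ((Bs : List (Subset n)) → RCD n R Bs → Σ (Vec ℕ n) (λ π → InSR312 n R π × chainOf n R π ≡ Bs))
    × ((π : Vec ℕ n) → InSR312 n R π → InUG n R (Ψ n R π))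
    × ((γ : Vec ℕ n) → InUG n R γ → InSR312 n R (Π n R γ))
    × ((π : Vec ℕ n) → InSR312 n R π → Π n R (Ψ n R π) ≡ π)
    × ((γ : Vec ℕ n) → InUG n R γ → Ψ n R (Π n R γ) ≡ γ)
proposition6p6 n n1 R V =
  chainOf-RCD , chainOf-injective , chainOf-onto , Ψ-gapless , Π-avoids312 , Π∘Ψ , Ψ∘Π
  where open Main n n1 R V
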